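{- (Subadditivity of Gr\"obner complexity and extension degree.) Let $V_1\subseteq\mathbb{F}_q^{m_1}$ and $V_2\subseteq\mathbb{F}_q^{m_2}$ be nonempty, and consider $V_1\times V_2\subseteq\mathbb{F}_q^{m_1+m_2}$, with coordinates $\mathbf{x}=(x_1,\dots,x_{m_1})$ for the first factor and $\mathbf{y}=(y_1,\dots,y_{m_2})$ for the second. Then: (1) if $\mathfrak{G}_1\subseteq\mathbb{F}_q[\mathbf{x}]$ and $\mathfrak{G}_2\subseteq\mathbb{F}_q[\mathbf{y}]$ are Gr\"obner generating sets of $\mathbb{I}(V_1)$ and $\mathbb{I}(V_2)$ respectively, then $\mathfrak{G}_1\cup\mathfrak{G}_2\subseteq\mathbb{F}_q[\mathbf{x},\mathbf{y}]$ is a Gr\"obner generating set of $\mathbb{I}(V_1\times V_2)$; (2) if $V_1,V_2$ have extension degrees $d_1,d_2$ respectively, then $V_1\times V_2$ has extension degree at most $d_1+d_2$. In particular, both Gr\"obner complexity and extension degree are subadditive under Cartesian products.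
   Context: For $V\subseteq\mathbb{F}_q^m$, $\mathbb{I}(V)$ denotes the ideal of polynomials in $\mathbb{F}_q[x_1,\dots,x_m]$ vanishing on $V$. For an ideal $\mathbb{I}$, a finite set $\mathfrak{G}\subseteq\mathbb{I}$ is a Gr\"obner generating set of $\mathbb{I}$ if every $P\in\mathbb{I}$ can be written $P=\sum_{g\in\mathfrak{G}} h_g g$ with polynomials $h_g$ satisfying $\deg(h_g g)\le\deg(P)$ for all $g$. The Gr\"obner complexity of $V$ is the minimum size of a Gr\"obner generating set of $\mathbb{I}(V)$. The extension degree of a nonempty $V$ is the least $d$ such that every function $f:V\to\mathbb{F}_q$ agrees on $V$ with a polynomial of total degree at most $d$. -}

module Defs where

open import Level using (0ℓ)
open import Data.Nat as ℕ using (ℕ; zero; suc; _≤_; _<_)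
open import Data.Fin using (Fin) renaming (zero to fzero; suc to fsuc)
open import Data.Product using (_×_; _,_; Σ; ∃; proj₁; proj₂)
open import Data.List as List using (List; []; _∷_; length; lookup)
open import Data.List.Membership.Propositional using (_∈_)
open import Data.List.Relation.Unary.All using (All)
open import Data.Vec as Vec using (Vec; zipWith; replicate)
open import Data.Vec.Properties using (≡-dec)
open import Data.Nat.Properties using () renaming (_≟_ to _≟ℕ_)
open import Relation.Binary.PropositionalEquality using (_≡_; _≢_)
open import Relation.Nullary using (¬_; yes; no)

record FiniteField : Set₁ where
  infixl 6 _+_
  infixl 7 _*_
  field
    Carrier : Set
    _+_ _*_ : Carrier → Carrier → Carrier
    -_      : Carrier → Carrier
    0# 1#   : Carrier
    _⁻¹     : (x : Carrier) → x ≢ 0# → Carrier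
    +-assoc : ∀ x y z → (x + y) + z ≡ x + (y + z)
    +-comm  : ∀ x y → x + y ≡ y + x
    +-idˡ   : ∀ x → 0# + x ≡ x
    -‿invˡ  : ∀ x → (- x) + x ≡ 0#
    *-assoc : ∀ x y z → (x * y) * z ≡ x * (y * z)
    *-comm  : ∀ x y → x * y ≡ y * x
    *-idˡ   : ∀ x → 1# * x ≡ x
    distribˡ : ∀ x y z → x * (y + z) ≡ (x * y) + (x * z)
    ⁻¹-invˡ : ∀ x (x≢0 : x ≢ 0#) → (x ⁻¹) x≢0 * x ≡ 1#
    0≢1     : 0# ≢ 1#
    -- finiteness: an explicit list of all elements (q = its length)
    elements : List Carrier
    complete : ∀ x → x ∈ elements

module Poly (F : FiniteField) where
  open FiniteField F

  Point : ℕ → Set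
  Point m = Vec Carrier m

  Exp : ℕ → Set
  Exp m = Vec ℕ m

  totalDeg : ∀ {m} → Exp m → ℕ
  totalDeg = Vec.sum

  -- formal polynomials in m variables: finite sums of terms c · x^e
  -- (a representation; equality is equality of coefficients, see _≈_)
  Pol : ℕ → Set
  Pol m = List (Carrier × Exp m)

  coeff : ∀ {m} → Pol m → Exp m → Carrier
  coeff []            e = 0#
  coeff ((c , e') ∷ p) e with ≡-dec _≟ℕ_ e' e
  ... | yes _ = c + coeff p e
  ... | no  _ = coeff p e

  _≈_ : ∀ {m} → Pol m → Pol m → Set
  p ≈ q = ∀ e → coeff p e ≡ coeff q e

  DegLe : ∀ {m} → Pol m → ℕ → Set
  DegLe p d = ∀ e → d < totalDeg e → coeff p e ≡ 0#

  0ₚ : ∀ {m} → Pol m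
  0ₚ = []

  _+ₚ_ : ∀ {m} → Pol m → Pol m → Pol m
  _+ₚ_ = List._++_

  _*ₚ_ : ∀ {m} → Pol m → Pol m → Pol m
  p *ₚ q = List.concatMap (λ { (c , e) → List.map (λ { (c' , e') → (c * c' , zipWith ℕ._+_ e e') }) q }) p

  pow : Carrier → ℕ → Carrier
  pow x zero    = 1#
  pow x (suc n) = x * pow x n

  evalMono : ∀ {m} → Exp m → Point m → Carrier
  evalMono e v = Vec.foldr _ _*_ 1# (zipWith pow v e)

  eval : ∀ {m} → Pol m → Point m → Carrier
  eval []            v = 0#
  eval ((c , e) ∷ p) v = c * evalMono e v + eval p v

  -- subsets V ⊆ F^m (necessarily finite) as lists of points
  Subset : ℕ → Set
  Subset m = List (Point m)

  Nonempty : ∀ {m} → Subset m → Set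
  Nonempty V = V ≢ []

  𝕀 : ∀ {m} → Subset m → Pol m → Set
  𝕀 V p = All (λ v → eval p v ≡ 0#) V

  combo : ∀ {m} (G : List (Pol m)) → (Fin (length G) → Pol m) → Pol m
  combo []      h = 0ₚ
  combo (g ∷ G) h = (h fzero *ₚ g) +ₚ combo G (λ i → h (fsuc i))

  IsGröbnerGenSet : ∀ {m} → (Pol m → Set) → List (Pol m) → Set
  IsGröbnerGenSet {m} I G =
    All I G ×
    (∀ (P : Pol m) → I P → ∀ d → DegLe P d →
      Σ (Fin (length G) → Pol m) λ h →
        (P ≈ combo G h) × (∀ i → DegLe (h i *ₚ lookup G i) d))

  -- every function V → F agrees on V with a polynomial of degree ≤ d
  -- (functions on V are represented as restrictions of functions F^m → F)
  ExtendsWithDeg : ∀ {m} → Subset m → ℕ → Set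
  ExtendsWithDeg {m} V d =
    ∀ (f : Point m → Carrier) →
      Σ (Pol m) λ P → DegLe P d × All (λ v → eval P v ≡ f v) V

  HasExtDeg : ∀ {m} → Subset m → ℕ → Set
  HasExtDeg V d = ExtendsWithDeg V d × (∀ d' → ExtendsWithDeg V d' → d ≤ d')

  _×ˢ_ : ∀ {m₁ m₂} → Subset m₁ → Subset m₂ → Subset (m₁ ℕ.+ m₂)
  V₁ ×ˢ V₂ = List.concatMap (λ u → List.map (λ w → u Vec.++ w) V₂) V₁

  embedˡ : ∀ {m₁} m₂ → Pol m₁ → Pol (m₁ ℕ.+ m₂)
  embedˡ m₂ = List.map (λ { (c , e) → (c , e Vec.++ replicate m₂ 0) })

  embedʳ : ∀ m₁ {m₂} → Pol m₂ → Pol (m₁ ℕ.+ m₂)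
  embedʳ m₁ = List.map (λ { (c , e) → (c , replicate m₁ 0 Vec.++ e) })

-- (1) Let P ∈ 𝕀(V₁ × V₂) have degree ≤ d, with terms c x^α y^β. Gaussian elimination of the monomials x^α
-- on V₁, in order of increasing degree, yields standard monomials S, linearly independent as functions
-- on V₁, and for each α a polynomial r_α supported on S with deg r_α ≤ |α| and r_α = x^α on V₁. Then
--   P = Σ c y^β (x^α − r_α) + Σ_{γ ∈ S} x^γ q_γ(y).
-- Each x^α − r_α lies in 𝕀(V₁) and has degree ≤ |α|, so G₁ expands it. Each q_γ has degree ≤ d − |γ| and
-- lies in 𝕀(V₂): for w ∈ V₂ the polynomial Σ_γ q_γ(w) x^γ vanishes on V₁ and is supported on S. So G₂
-- expands it.
-- (2) f(u, w) = Σ_{u₀ ∈ V₁} [u = u₀] f(u₀, w); extending [· = u₀] to degree d₁ on V₁ and f(u₀, ·) to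
-- degree d₂ on V₂ turns each summand into a product of degree ≤ d₁ + d₂.

module Submission where

open import Defs
open import Level using (0ℓ)
open import Algebra.Bundles using (CommutativeRing)
open import Algebra.Structures using (IsCommutativeRing)
open import Algebra.Consequences.Propositional using (comm∧idˡ⇒id; comm∧invˡ⇒inv; comm∧distrˡ⇒distrʳ)
open import Function using (_∘_)
open import Data.Nat as ℕ using (ℕ; _≤_; _<_; _∸_)
import Data.Nat.Properties as ℕ
open import Data.Fin using (Fin; zero; suc) renaming (_≟_ to _≟Fin_)
open import Data.Product using (Σ; _×_; _,_; proj₁; proj₂)
open import Data.Sum using (_⊎_; inj₁; inj₂)
open import Data.List as List using (List; []; _∷_; _++_; map; filter; concatMap; deduplicate; length; lookup)
import Data.List.Properties as List
open import Data.List.Membership.Propositional using (_∈_; _∉_; find)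
open import Data.List.Membership.Propositional.Properties using (∈-map⁺; ∈-filter⁺; ∈-filter⁻; ∈-deduplicate⁺)
open import Data.List.Relation.Unary.All as All using (All; []; _∷_)
import Data.List.Relation.Unary.All.Properties as All
open import Data.List.Relation.Unary.AllPairs using (AllPairs; []; _∷_)
open import Data.List.Relation.Unary.Any using (here; there; index)
open import Data.List.Relation.Unary.Any.Properties using (lookup-index)
open import Data.List.Relation.Unary.Linked.Properties using (Linked⇒AllPairs)
open import Data.List.Relation.Unary.Unique.Propositional using (Unique; []; _∷_)
import Data.List.Relation.Unary.Unique.Propositional.Properties as Unique
open import Data.List.Relation.Unary.Unique.DecPropositional.Properties using (deduplicate-!)
open import Data.List.Relation.Binary.Permutation.Propositional using (↭-sym)
open import Data.List.Relation.Binary.Permutation.Propositional.Properties using (∈-resp-↭)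
open import Data.Vec as Vec using (Vec; []; _∷_; replicate; zipWith; splitAt; take; drop)
import Data.Vec.Properties as Vec
open import Relation.Binary.Bundles using (Setoid)
open import Relation.Binary.Definitions using (DecidableEquality)
import Relation.Binary.Construct.On as On
import Relation.Binary.Construct.Flip.EqAndOrd as Flip
open import Relation.Binary.PropositionalEquality
open import Relation.Nullary using (¬_; Dec; yes; no; ¬?; contradiction)
open import Relation.Unary using (Pred; Decidable)

+-<⇒<⊎< : ∀ {a b c d} → a ℕ.+ b < c ℕ.+ d → a < c ⊎ b < d
+-<⇒<⊎< {a} {b} {c} {d} a+b<c+d with a ℕ.<? c | b ℕ.<? d
... | yes a<c | _       = inj₁ a<c
... | no _    | yes b<d = inj₂ b<d
... | no a≮c  | no b≮d  = contradiction (ℕ.+-mono-≤ (ℕ.≮⇒≥ a≮c) (ℕ.≮⇒≥ b≮d)) (ℕ.<⇒≱ a+b<c+d)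

+≤∸<⇒< : ∀ {a b d g} → a ℕ.+ b ≤ d → d ℕ.∸ g < b → a < g
+≤∸<⇒< {a} {b} {d} {g} a+b≤d d∸g<b with g ℕ.≤? d
... | yes g≤d = ℕ.+-cancelʳ-< b a g (begin-strict
  a ℕ.+ b          ≤⟨ a+b≤d ⟩
  d                ≡⟨ ℕ.m+[n∸m]≡n g≤d ⟨
  g ℕ.+ (d ℕ.∸ g)  <⟨ ℕ.+-monoʳ-< g d∸g<b ⟩
  g ℕ.+ b          ∎)
  where open ℕ.≤-Reasoning
... | no g≰d = ℕ.≤-<-trans (ℕ.m+n≤o⇒m≤o a a+b≤d) (ℕ.≰⇒> g≰d)

zipWith-+-++-0ʳ : ∀ {m₁ m₂} (e e' : Vec ℕ m₁) (β : Vec ℕ m₂) →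
          zipWith ℕ._+_ (e Vec.++ β) (e' Vec.++ replicate m₂ 0) ≡ zipWith ℕ._+_ e e' Vec.++ β
zipWith-+-++-0ʳ e e' β = trans (Vec.zipWith-++ ℕ._+_ e β e' _) (cong (_ Vec.++_) (Vec.zipWith-identityʳ ℕ.+-identityʳ β))

zipWith-+-++-0ˡ : ∀ {m₁ m₂} (γ : Vec ℕ m₁) (e e' : Vec ℕ m₂) →
          zipWith ℕ._+_ (γ Vec.++ e) (replicate m₁ 0 Vec.++ e') ≡ γ Vec.++ zipWith ℕ._+_ e e'
zipWith-+-++-0ˡ γ e e' = trans (Vec.zipWith-++ ℕ._+_ γ e _ e') (cong (Vec._++ _) (Vec.zipWith-identityʳ ℕ.+-identityʳ γ))

module FieldProperties (F : FiniteField) where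
  open FiniteField F

  isCommutativeRing : IsCommutativeRing _≡_ _+_ _*_ -_ 0# 1#
  isCommutativeRing = record
    { isRing = record
      { +-isAbelianGroup = record
        { isGroup = record
          { isMonoid = record
            { isSemigroup = record
              { isMagma = record { isEquivalence = isEquivalence ; ∙-cong = cong₂ _+_ }
              ; assoc = +-assoc }
            ; identity = comm∧idˡ⇒id +-comm +-idˡ }
          ; inverse = comm∧invˡ⇒inv +-comm -‿invˡ
          ; ⁻¹-cong = cong -_ }
        ; comm = +-comm }
      ; *-cong = cong₂ _*_
      ; *-assoc = *-assoc
      ; *-identity = comm∧idˡ⇒id *-comm *-idˡ
      ; distrib = distribˡ , comm∧distrˡ⇒distrʳ *-comm distribˡ }
    ; *-comm = *-comm }

  commutativeRing : CommutativeRing 0ℓ 0ℓ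
  commutativeRing = record { isCommutativeRing = isCommutativeRing }

  open CommutativeRing commutativeRing public
    using ( +-identityʳ; *-identityʳ; zeroˡ; zeroʳ; distribʳ; -‿inverseʳ
          ; ring; +-abelianGroup; +-commutativeSemigroup; *-commutativeSemigroup)

  -- Elements are compared through their positions in the enumeration.
  _≟_ : DecidableEquality Carrier
  x ≟ y with index (complete x) ≟Fin index (complete y)
  ... | yes i≡j = yes (begin
    x                                 ≡⟨ lookup-index (complete x) ⟩
    lookup elements (index (complete x)) ≡⟨ cong (lookup elements) i≡j ⟩
    lookup elements (index (complete y)) ≡⟨ lookup-index (complete y) ⟨
    y                                 ∎)
    where open ≡-Reasoning
  ... | no i≢j = no (λ { refl → i≢j refl })

  *-inverse-cancelˡ : ∀ c (c≢0 : c ≢ 0#) x → c * ((c ⁻¹) c≢0 * x) ≡ x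
  *-inverse-cancelˡ c c≢0 x = begin
    c * ((c ⁻¹) c≢0 * x)  ≡⟨ *-assoc c _ x ⟨
    (c * (c ⁻¹) c≢0) * x  ≡⟨ cong (_* x) (trans (*-comm c _) (⁻¹-invˡ c c≢0)) ⟩
    1# * x                ≡⟨ *-idˡ x ⟩
    x                     ∎
    where open ≡-Reasoning

  *-inverse-cancelʳ : ∀ c (c≢0 : c ≢ 0#) x → (c ⁻¹) c≢0 * (c * x) ≡ x
  *-inverse-cancelʳ c c≢0 x = begin
    (c ⁻¹) c≢0 * (c * x)  ≡⟨ *-assoc _ c x ⟨
    ((c ⁻¹) c≢0 * c) * x  ≡⟨ cong (_* x) (⁻¹-invˡ c c≢0) ⟩
    1# * x                ≡⟨ *-idˡ x ⟩
    x                     ∎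
    where open ≡-Reasoning

module PolynomialProperties (F : FiniteField) where
  open FiniteField F
  open Poly F
  open FieldProperties F

  _≟ₑ_ : ∀ {m} → DecidableEquality (Exp m)
  _≟ₑ_ = Vec.≡-dec ℕ._≟_

  ∑ : ∀ {a} {A : Set a} → List A → (A → Carrier) → Carrier
  ∑ xs f = List.foldr (λ x s → f x + s) 0# xs

  ∑-zero : ∀ {a} {A : Set a} (xs : List A) {f : A → Carrier} →
           (∀ {x} → x ∈ xs → f x ≡ 0#) → ∑ xs f ≡ 0#
  ∑-zero []       f≡0 = refl
  ∑-zero (x ∷ xs) f≡0 =
    trans (cong₂ _+_ (f≡0 (here refl)) (∑-zero xs (f≡0 ∘ there))) (+-idˡ 0#)

  ∑-unique : ∀ {a} {A : Set a} {xs : List A} {x} {f : A → Carrier} → Unique xs → x ∈ xs →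
             (∀ {y} → y ≢ x → f y ≡ 0#) → ∑ xs f ≡ f x
  ∑-unique {xs = y ∷ xs} (y∉xs ∷ _) (here refl) f≡0 =
    trans (cong (_ +_) (∑-zero xs (λ z∈xs → f≡0 (≢-sym (All.lookup y∉xs z∈xs))))) (+-identityʳ _)
  ∑-unique {xs = y ∷ xs} (y∉xs ∷ unique) (there x∈xs) f≡0 =
    trans (cong₂ _+_ (f≡0 (All.lookup y∉xs x∈xs)) (∑-unique unique x∈xs f≡0)) (+-idˡ _)

  ∑-+ : ∀ {a} {A : Set a} (xs : List A) (f g : A → Carrier) → ∑ xs (λ x → f x + g x) ≡ ∑ xs f + ∑ xs g
  ∑-+ []       f g = sym (+-idˡ 0#)
  ∑-+ (x ∷ xs) f g = trans (cong (_ +_) (∑-+ xs f g)) (interchange _ _ _ _)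
    where open import Algebra.Properties.CommutativeSemigroup +-commutativeSemigroup using (interchange)

  ∑-cong : ∀ {a} {A : Set a} (xs : List A) {f g : A → Carrier} → (∀ {x} → x ∈ xs → f x ≡ g x) → ∑ xs f ≡ ∑ xs g
  ∑-cong []       f≡g = refl
  ∑-cong (x ∷ xs) f≡g = cong₂ _+_ (f≡g (here refl)) (∑-cong xs (f≡g ∘ there))

  module _ {m : ℕ} where
    open ≡-Reasoning

    ≈-setoid : Setoid 0ℓ 0ℓ
    ≈-setoid = record
      { Carrier = Pol m
      ; _≈_ = _≈_
      ; isEquivalence = record
        { refl = λ _ → refl
        ; sym = λ p≈q e → sym (p≈q e)
        ; trans = λ p≈q q≈r e → trans (p≈q e) (q≈r e) } }

    coeff-∷-≡ : ∀ c e (p : Pol m) → coeff ((c , e) ∷ p) e ≡ c + coeff p e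
    coeff-∷-≡ c e p with e ≟ₑ e
    ... | yes _  = refl
    ... | no e≢e = contradiction refl e≢e

    coeff-∷-≢ : ∀ c {e' e} (p : Pol m) → e' ≢ e → coeff ((c , e') ∷ p) e ≡ coeff p e
    coeff-∷-≢ c {e'} {e} p e'≢e with e' ≟ₑ e
    ... | yes e'≡e = contradiction e'≡e e'≢e
    ... | no _     = refl

    coeff-∷-vanishing : ∀ {k} e (p : Pol m) y → (e ≡ y → k ≡ 0#) → coeff ((k , e) ∷ p) y ≡ coeff p y
    coeff-∷-vanishing {k} e p y k≡0 with e ≟ₑ y
    ... | yes e≡y = trans (cong (_+ coeff p y) (k≡0 e≡y)) (+-idˡ _)
    ... | no _    = refl

    coeff-+ₚ : ∀ (p q : Pol m) e → coeff (p +ₚ q) e ≡ coeff p e + coeff q e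
    coeff-+ₚ []             q e = sym (+-idˡ _)
    coeff-+ₚ ((c , e') ∷ p) q e with e' ≟ₑ e
    ... | yes _ = trans (cong (c +_) (coeff-+ₚ p q e)) (sym (+-assoc c _ _))
    ... | no _  = coeff-+ₚ p q e

    eval-+ₚ : ∀ (p q : Pol m) v → eval (p +ₚ q) v ≡ eval p v + eval q v
    eval-+ₚ []            q v = sym (+-idˡ _)
    eval-+ₚ ((c , e) ∷ p) q v = trans (cong (_ +_) (eval-+ₚ p q v)) (sym (+-assoc _ _ _))

    +ₚ-cong : ∀ (p p' q q' : Pol m) → p ≈ p' → q ≈ q' → (p +ₚ q) ≈ (p' +ₚ q')
    +ₚ-cong p p' q q' p≈p' q≈q' e =
      trans (coeff-+ₚ p q e) (trans (cong₂ _+_ (p≈p' e) (q≈q' e)) (sym (coeff-+ₚ p' q' e)))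

    +ₚ-interchange : ∀ (a b c d : Pol m) → ((a +ₚ b) +ₚ (c +ₚ d)) ≈ ((a +ₚ c) +ₚ (b +ₚ d))
    +ₚ-interchange a b c d e = begin
      coeff ((a +ₚ b) +ₚ (c +ₚ d)) e                      ≡⟨ coeff-+ₚ (a +ₚ b) (c +ₚ d) e ⟩
      coeff (a +ₚ b) e + coeff (c +ₚ d) e                 ≡⟨ cong₂ _+_ (coeff-+ₚ a b e) (coeff-+ₚ c d e) ⟩
      (coeff a e + coeff b e) + (coeff c e + coeff d e)   ≡⟨ interchange _ _ _ _ ⟩
      (coeff a e + coeff c e) + (coeff b e + coeff d e)   ≡⟨ cong₂ _+_ (coeff-+ₚ a c e) (coeff-+ₚ b d e) ⟨
      coeff (a +ₚ c) e + coeff (b +ₚ d) e                 ≡⟨ coeff-+ₚ (a +ₚ c) (b +ₚ d) e ⟨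
      coeff ((a +ₚ c) +ₚ (b +ₚ d)) e                      ∎
      where
      open ≡-Reasoning
      open import Algebra.Properties.CommutativeSemigroup +-commutativeSemigroup using (interchange)

    scale : Carrier → Pol m → Pol m
    scale k = map (λ (c , e) → (k * c , e))

    coeff-scale : ∀ k (p : Pol m) e → coeff (scale k p) e ≡ k * coeff p e
    coeff-scale k []             e = sym (zeroʳ k)
    coeff-scale k ((c , e') ∷ p) e with e' ≟ₑ e
    ... | yes _ = trans (cong (k * c +_) (coeff-scale k p e)) (sym (distribˡ k c _))
    ... | no _  = coeff-scale k p e

    eval-scale : ∀ k (p : Pol m) v → eval (scale k p) v ≡ k * eval p v
    eval-scale k []            v = sym (zeroʳ k)
    eval-scale k ((c , e) ∷ p) v =
      trans (cong₂ _+_ (*-assoc k c _) (eval-scale k p v)) (sym (distribˡ k _ _))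

    scale-zero : ∀ {k} (p : Pol m) → k ≡ 0# → scale k p ≈ 0ₚ
    scale-zero {k} p refl e = trans (coeff-scale 0# p e) (zeroˡ _)

    scale-neg-cancel : ∀ (p : Pol m) → (scale (- 1#) p +ₚ p) ≈ 0ₚ
    scale-neg-cancel p e =
      trans (coeff-+ₚ (scale (- 1#) p) p e)
            (trans (cong (_+ coeff p e) (trans (coeff-scale (- 1#) p e) (-1*x≈-x _))) (-‿invˡ _))
      where open import Algebra.Properties.Ring ring using (-1*x≈-x)

    module _ {P : Pred (Exp m) 0ℓ} (P? : Decidable P) where

      coeff-filter-accept : ∀ (p : Pol m) {e} → P e → coeff (filter (P? ∘ proj₂) p) e ≡ coeff p e
      coeff-filter-accept []             Pe = refl
      coeff-filter-accept ((c , e') ∷ p) {e} Pe with P? e'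
      ... | yes _ with e' ≟ₑ e
      ...   | yes _ = cong (c +_) (coeff-filter-accept p Pe)
      ...   | no _  = coeff-filter-accept p Pe
      coeff-filter-accept ((c , e') ∷ p) {e} Pe | no ¬Pe' with e' ≟ₑ e
      ...   | yes refl = contradiction Pe ¬Pe'
      ...   | no _     = coeff-filter-accept p Pe

      coeff-filter-reject : ∀ (p : Pol m) {e} → ¬ P e → coeff (filter (P? ∘ proj₂) p) e ≡ 0#
      coeff-filter-reject []             ¬Pe = refl
      coeff-filter-reject ((c , e') ∷ p) {e} ¬Pe with P? e'
      ... | no _ = coeff-filter-reject p ¬Pe
      ... | yes Pe' with e' ≟ₑ e
      ...   | yes refl = contradiction Pe' ¬Pe
      ...   | no _     = coeff-filter-reject p ¬Pe

    remove : Exp m → Pol m → Pol m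
    remove α = filter (λ t → ¬? (proj₂ t ≟ₑ α))

    eval-remove : ∀ α (p : Pol m) v → eval p v ≡ coeff p α * evalMono α v + eval (remove α p) v
    eval-remove α []            v = sym (trans (cong (_+ 0#) (zeroˡ _)) (+-idˡ 0#))
    eval-remove α ((c , e) ∷ p) v with e ≟ₑ α
    ... | yes refl = begin
      c * evalMono e v + eval p v
        ≡⟨ cong (_ +_) (eval-remove e p v) ⟩
      c * evalMono e v + (coeff p e * evalMono e v + eval (remove e p) v)
        ≡⟨ +-assoc _ _ _ ⟨
      (c * evalMono e v + coeff p e * evalMono e v) + eval (remove e p) v
        ≡⟨ cong (_+ eval (remove e p) v) (distribʳ (evalMono e v) c (coeff p e)) ⟨
      (c + coeff p e) * evalMono e v + eval (remove e p) v
        ∎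
    ... | no _ = begin
      c * evalMono e v + eval p v                                 ≡⟨ cong (_ +_) (eval-remove α p v) ⟩
      c * evalMono e v + (coeff p α * evalMono α v + eval (remove α p) v) ≡⟨ x∙yz≈y∙xz _ _ _ ⟩
      coeff p α * evalMono α v + (c * evalMono e v + eval (remove α p) v) ∎
      where open import Algebra.Properties.CommutativeSemigroup +-commutativeSemigroup using (x∙yz≈y∙xz)

    ≈0⇒eval≡0 : ∀ (p : Pol m) → p ≈ 0ₚ → ∀ v → eval p v ≡ 0#
    ≈0⇒eval≡0 p p≈0 v = go (length p) p ℕ.≤-refl p≈0
      where
      go : ∀ n (p : Pol m) → length p ≤ n → p ≈ 0ₚ → eval p v ≡ 0#
      go _       []             _             _   = refl
      go (ℕ.suc n) p@((c , α) ∷ p') (ℕ.s≤s |p'|≤n) p≈0 = begin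
        eval p v                                          ≡⟨ eval-remove α p v ⟩
        coeff p α * evalMono α v + eval (remove α p) v    ≡⟨ cong₂ _+_ (trans (cong (_* _) (p≈0 α)) (zeroˡ _)) rest≡0 ⟩
        0# + 0#                                           ≡⟨ +-idˡ 0# ⟩
        0#                                                ∎
        where
        rest≈0 : remove α p' ≈ 0ₚ
        rest≈0 e with e ≟ₑ α
        ... | yes refl = coeff-filter-reject _ p' (λ ¬α≡α → ¬α≡α refl)
        ... | no e≢α   = trans (coeff-filter-accept _ p' e≢α) (trans (sym (coeff-∷-≢ c p' (≢-sym e≢α))) (p≈0 e))
        rest≡0 : eval (remove α p) v ≡ 0#
        rest≡0 rewrite List.filter-reject (λ t → ¬? (proj₂ t ≟ₑ α)) {x = c , α} {xs = p'} (λ ¬α≡α → ¬α≡α refl) =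
          go n (remove α p') (ℕ.≤-trans (List.length-filter _ p') |p'|≤n) rest≈0

    eval-cong : ∀ (p q : Pol m) → p ≈ q → ∀ v → eval p v ≡ eval q v
    eval-cong p q p≈q v = x∙y⁻¹≈ε⇒x≈y _ _ (begin
      eval p v + - eval q v                     ≡⟨ cong (eval p v +_) (-1*x≈-x _) ⟨
      eval p v + - 1# * eval q v                ≡⟨ cong (eval p v +_) (eval-scale (- 1#) q v) ⟨
      eval p v + eval (scale (- 1#) q) v         ≡⟨ eval-+ₚ p (scale (- 1#) q) v ⟨
      eval (p +ₚ scale (- 1#) q) v               ≡⟨ ≈0⇒eval≡0 (p +ₚ scale (- 1#) q) difference≈0 v ⟩
      0#                                         ∎)
      where
      open import Algebra.Properties.Ring ring using (-1*x≈-x)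
      open import Algebra.Properties.AbelianGroup +-abelianGroup using (x∙y⁻¹≈ε⇒x≈y)
      difference≈0 : (p +ₚ scale (- 1#) q) ≈ 0ₚ
      difference≈0 e = begin
        coeff (p +ₚ scale (- 1#) q) e          ≡⟨ coeff-+ₚ p _ e ⟩
        coeff p e + coeff (scale (- 1#) q) e   ≡⟨ cong (coeff p e +_) (coeff-scale (- 1#) q e) ⟩
        coeff p e + - 1# * coeff q e           ≡⟨ cong (λ z → coeff p e + - 1# * z) (p≈q e) ⟨
        coeff p e + - 1# * coeff p e           ≡⟨ cong (coeff p e +_) (-1*x≈-x _) ⟩
        coeff p e + - coeff p e                ≡⟨ -‿inverseʳ _ ⟩
        0#                                     ∎

    DegLe-cong : ∀ (p q : Pol m) {d} → p ≈ q → DegLe q d → DegLe p d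
    DegLe-cong p q p≈q q≤d e d<e = trans (p≈q e) (q≤d e d<e)

    DegLe-0ₚ : ∀ {d} → DegLe (0ₚ {m}) d
    DegLe-0ₚ e _ = refl

    DegLe-mono : ∀ (p : Pol m) {d d'} → d ≤ d' → DegLe p d → DegLe p d'
    DegLe-mono p d≤d' p≤d e d'<e = p≤d e (ℕ.≤-<-trans d≤d' d'<e)

    DegLe-+ₚ : ∀ (p q : Pol m) {d} → DegLe p d → DegLe q d → DegLe (p +ₚ q) d
    DegLe-+ₚ p q p≤d q≤d e d<e =
      trans (coeff-+ₚ p q e) (trans (cong₂ _+_ (p≤d e d<e) (q≤d e d<e)) (+-idˡ 0#))

    DegLe-scale : ∀ k (p : Pol m) {d} → DegLe p d → DegLe (scale k p) d
    DegLe-scale k p p≤d e d<e = trans (coeff-scale k p e) (trans (cong (k *_) (p≤d e d<e)) (zeroʳ k))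

    DegLe-∷ : ∀ c e (p : Pol m) {d} → totalDeg e ≤ d → DegLe p d → DegLe ((c , e) ∷ p) d
    DegLe-∷ c e p e≤d p≤d e' d<e' =
      trans (coeff-∷-≢ c {e} p (λ { refl → ℕ.<⇒≱ d<e' e≤d })) (p≤d e' d<e')

    DegLe⇒truncate≈ : ∀ (p : Pol m) {d} → DegLe p d → filter (λ t → totalDeg (proj₂ t) ℕ.≤? d) p ≈ p
    DegLe⇒truncate≈ p {d} p≤d e with totalDeg e ℕ.≤? d
    ... | yes e≤d = coeff-filter-accept (λ e → totalDeg e ℕ.≤? d) p e≤d
    ... | no e≰d  = trans (coeff-filter-reject (λ e → totalDeg e ℕ.≤? d) p e≰d) (sym (p≤d e (ℕ.≰⇒> e≰d)))

    SupportedIn : List (Exp m) → Pol m → Set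
    SupportedIn S p = All (λ t → proj₂ t ∈ S) p

    SupportedIn-scale : ∀ {S} k {p : Pol m} → SupportedIn S p → SupportedIn S (scale k p)
    SupportedIn-scale k = All.map⁺

    SupportedIn-remove : ∀ {α S} {q : Pol m} → SupportedIn (α ∷ S) q → SupportedIn S (remove α q)
    SupportedIn-remove {α} {S} {q} q⊆α∷S = All.zipWith
      (λ { (here refl , α≢α) → contradiction refl α≢α ; (there γ∈S , _) → γ∈S })
      (All.filter⁺ _ q⊆α∷S , All.all-filter _ q)

    coeff-unsupported : ∀ {S} (p : Pol m) {e} → SupportedIn S p → e ∉ S → coeff p e ≡ 0#
    coeff-unsupported []             []          e∉S = refl
    coeff-unsupported ((c , e') ∷ p) {e} (e'∈S ∷ p⊆S) e∉S with e' ≟ₑ e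
    ... | yes refl = contradiction e'∈S e∉S
    ... | no _     = coeff-unsupported p p⊆S e∉S

  module _ {a} {A : Set a} {m : ℕ} where
    open ≡-Reasoning

    coeff-concatMap : ∀ (f : A → Pol m) xs e → coeff (concatMap f xs) e ≡ ∑ xs (λ x → coeff (f x) e)
    coeff-concatMap f []       e = refl
    coeff-concatMap f (x ∷ xs) e =
      trans (coeff-+ₚ (f x) (concatMap f xs) e) (cong (_ +_) (coeff-concatMap f xs e))

    eval-concatMap : ∀ (f : A → Pol m) xs v → eval (concatMap f xs) v ≡ ∑ xs (λ x → eval (f x) v)
    eval-concatMap f []       v = refl
    eval-concatMap f (x ∷ xs) v =
      trans (eval-+ₚ (f x) (concatMap f xs) v) (cong (_ +_) (eval-concatMap f xs v))

    concatMap-cong : ∀ (f g : A → Pol m) xs → (∀ {x} → x ∈ xs → f x ≈ g x) → concatMap f xs ≈ concatMap g xs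
    concatMap-cong f g xs f≈g e = begin
      coeff (concatMap f xs) e    ≡⟨ coeff-concatMap f xs e ⟩
      ∑ xs (λ x → coeff (f x) e)  ≡⟨ ∑-cong xs (λ x∈xs → f≈g x∈xs e) ⟩
      ∑ xs (λ x → coeff (g x) e)  ≡⟨ coeff-concatMap g xs e ⟨
      coeff (concatMap g xs) e    ∎

    concatMap-+ₚ : ∀ (f g : A → Pol m) xs → concatMap (λ x → f x +ₚ g x) xs ≈ (concatMap f xs +ₚ concatMap g xs)
    concatMap-+ₚ f g xs e = begin
      coeff (concatMap (λ x → f x +ₚ g x) xs) e                  ≡⟨ coeff-concatMap _ xs e ⟩
      ∑ xs (λ x → coeff (f x +ₚ g x) e)                          ≡⟨ ∑-cong xs (λ {x} _ → coeff-+ₚ (f x) (g x) e) ⟩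
      ∑ xs (λ x → coeff (f x) e + coeff (g x) e)                 ≡⟨ ∑-+ xs _ _ ⟩
      ∑ xs (λ x → coeff (f x) e) + ∑ xs (λ x → coeff (g x) e)    ≡⟨ cong₂ _+_ (coeff-concatMap f xs e) (coeff-concatMap g xs e) ⟨
      coeff (concatMap f xs) e + coeff (concatMap g xs) e        ≡⟨ coeff-+ₚ (concatMap f xs) _ e ⟨
      coeff (concatMap f xs +ₚ concatMap g xs) e                 ∎

    DegLe-concatMap : ∀ (f : A → Pol m) xs {d} → (∀ {x} → x ∈ xs → DegLe (f x) d) → DegLe (concatMap f xs) d
    DegLe-concatMap f []       f≤d = DegLe-0ₚ
    DegLe-concatMap f (x ∷ xs) f≤d = DegLe-+ₚ (f x) (concatMap f xs) (f≤d (here refl)) (DegLe-concatMap f xs (f≤d ∘ there))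

    SupportedIn-concatMap : ∀ {S} (f : A → Pol m) xs → (∀ {x} → x ∈ xs → SupportedIn S (f x)) →
                            SupportedIn S (concatMap f xs)
    SupportedIn-concatMap f xs f⊆S = All.concat⁺ (All.map⁺ (All.tabulate f⊆S))

  evalMono-++ : ∀ {m₁ m₂} (a : Exp m₁) (b : Exp m₂) u w →
                evalMono (a Vec.++ b) (u Vec.++ w) ≡ evalMono a u * evalMono b w
  evalMono-++ []      b []      w = sym (*-idˡ _)
  evalMono-++ (i ∷ a) b (x ∷ u) w = trans (cong (pow x i *_) (evalMono-++ a b u w)) (sym (*-assoc _ _ _))

  evalMono-0 : ∀ {m} (v : Point m) → evalMono (replicate m 0) v ≡ 1#
  evalMono-0 []      = refl
  evalMono-0 (x ∷ v) = trans (*-idˡ _) (evalMono-0 v)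

  module _ {m₁ m₂ : ℕ} where
    open ≡-Reasoning

    eval-embedˡ : ∀ (p : Pol m₁) u (w : Point m₂) → eval (embedˡ m₂ p) (u Vec.++ w) ≡ eval p u
    eval-embedˡ []            u w = refl
    eval-embedˡ ((c , e) ∷ p) u w = cong₂ _+_
      (cong (c *_) (trans (evalMono-++ e _ u w) (trans (cong (_ *_) (evalMono-0 w)) (*-identityʳ _))))
      (eval-embedˡ p u w)

    eval-embedʳ : ∀ (p : Pol m₂) (u : Point m₁) w → eval (embedʳ m₁ p) (u Vec.++ w) ≡ eval p w
    eval-embedʳ []            u w = refl
    eval-embedʳ ((c , e) ∷ p) u w = cong₂ _+_
      (cong (c *_) (trans (evalMono-++ _ e u w) (trans (cong (_* _) (evalMono-0 u)) (*-idˡ _))))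
      (eval-embedʳ p u w)

    liftˡ : Carrier → Exp m₂ → Pol m₁ → Pol (m₁ ℕ.+ m₂)
    liftˡ c β = map (λ (c' , e) → (c * c' , e Vec.++ β))

    liftʳ : Exp m₁ → Pol m₂ → Pol (m₁ ℕ.+ m₂)
    liftʳ γ = map (λ (c , e) → (c , γ Vec.++ e))

    coeff-liftˡ-≡ : ∀ c β (p : Pol m₁) x → coeff (liftˡ c β p) (x Vec.++ β) ≡ c * coeff p x
    coeff-liftˡ-≡ c β []             x = sym (zeroʳ c)
    coeff-liftˡ-≡ c β ((c' , e) ∷ p) x with e ≟ₑ x
    ... | yes refl = begin
      coeff (liftˡ c β ((c' , e) ∷ p)) (e Vec.++ β) ≡⟨ coeff-∷-≡ (c * c') (e Vec.++ β) (liftˡ c β p) ⟩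
      c * c' + coeff (liftˡ c β p) (e Vec.++ β)    ≡⟨ cong (c * c' +_) (coeff-liftˡ-≡ c β p e) ⟩
      c * c' + c * coeff p e                      ≡⟨ distribˡ c c' _ ⟨
      c * (c' + coeff p e)                        ∎
    ... | no e≢x = begin
      coeff (liftˡ c β ((c' , e) ∷ p)) (x Vec.++ β) ≡⟨ coeff-∷-≢ (c * c') (liftˡ c β p) (e≢x ∘ Vec.++-injectiveˡ e x) ⟩
      coeff (liftˡ c β p) (x Vec.++ β)             ≡⟨ coeff-liftˡ-≡ c β p x ⟩
      c * coeff p x                                ∎

    coeff-liftˡ-≢ : ∀ c {β y} (p : Pol m₁) x → β ≢ y → coeff (liftˡ c β p) (x Vec.++ y) ≡ 0#
    coeff-liftˡ-≢ c []             x β≢y = refl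
    coeff-liftˡ-≢ c ((c' , e) ∷ p) x β≢y =
      trans (coeff-∷-≢ (c * c') (liftˡ c _ p) (β≢y ∘ Vec.++-injectiveʳ e x)) (coeff-liftˡ-≢ c p x β≢y)

    coeff-liftˡ : ∀ c β (p : Pol m₁) x y → coeff (liftˡ c β p) (x Vec.++ y) ≡ coeff ((c * coeff p x , β) ∷ []) y
    coeff-liftˡ c β p x y with β ≟ₑ y
    ... | yes refl = trans (coeff-liftˡ-≡ c β p x) (sym (+-identityʳ _))
    ... | no β≢y   = coeff-liftˡ-≢ c p x β≢y

    coeff-liftʳ-≡ : ∀ γ (q : Pol m₂) y → coeff (liftʳ γ q) (γ Vec.++ y) ≡ coeff q y
    coeff-liftʳ-≡ γ []            y = refl
    coeff-liftʳ-≡ γ ((c , e) ∷ q) y with e ≟ₑ y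
    ... | yes refl = trans (coeff-∷-≡ c (γ Vec.++ e) (liftʳ γ q)) (cong (c +_) (coeff-liftʳ-≡ γ q e))
    ... | no e≢y   = trans (coeff-∷-≢ c (liftʳ γ q) (e≢y ∘ Vec.++-injectiveʳ γ γ)) (coeff-liftʳ-≡ γ q y)

    coeff-liftʳ-≢ : ∀ {γ x} (q : Pol m₂) y → γ ≢ x → coeff (liftʳ γ q) (x Vec.++ y) ≡ 0#
    coeff-liftʳ-≢ {γ} {x} []            y γ≢x = refl
    coeff-liftʳ-≢ {γ} {x} ((c , e) ∷ q) y γ≢x =
      trans (coeff-∷-≢ c (liftʳ γ q) (γ≢x ∘ Vec.++-injectiveˡ γ x)) (coeff-liftʳ-≢ q y γ≢x)

    coeff-liftʳ : ∀ γ (q : Pol m₂) x y → coeff (liftʳ γ q) (x Vec.++ y) ≡ coeff ((coeff q y , γ) ∷ []) x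
    coeff-liftʳ γ q x y with γ ≟ₑ x
    ... | yes refl = trans (coeff-liftʳ-≡ γ q y) (sym (+-identityʳ _))
    ... | no γ≢x   = coeff-liftʳ-≢ q y γ≢x

    DegLe-liftˡ : ∀ c β (p : Pol m₁) {k} → DegLe p k → DegLe (liftˡ c β p) (k ℕ.+ totalDeg β)
    DegLe-liftˡ c β p {k} p≤k e k+β<e with splitAt m₁ e
    ... | x , y , refl with y ≟ₑ β
    ...   | no y≢β   = coeff-liftˡ-≢ c p x (≢-sym y≢β)
    ...   | yes refl = trans (coeff-liftˡ-≡ c y p x) (trans (cong (c *_) (p≤k x k<x)) (zeroʳ c))
      where
      k<x : k < totalDeg x
      k<x = ℕ.+-cancelʳ-< (totalDeg y) k (totalDeg x) (subst (k ℕ.+ totalDeg y <_) (Vec.sum-++ x) k+β<e)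

    DegLe-liftʳ : ∀ γ (q : Pol m₂) {k} → DegLe q k → DegLe (liftʳ γ q) (totalDeg γ ℕ.+ k)
    DegLe-liftʳ γ q {k} q≤k e γ+k<e with splitAt m₁ e
    ... | x , y , refl with x ≟ₑ γ
    ...   | no x≢γ   = coeff-liftʳ-≢ q y (≢-sym x≢γ)
    ...   | yes refl = trans (coeff-liftʳ-≡ x q y) (q≤k y k<y)
      where
      k<y : k < totalDeg y
      k<y = ℕ.+-cancelˡ-< (totalDeg x) k (totalDeg y) (subst (totalDeg x ℕ.+ k <_) (Vec.sum-++ x) γ+k<e)

    liftˡ-cong : ∀ c β (p q : Pol m₁) → p ≈ q → liftˡ c β p ≈ liftˡ c β q
    liftˡ-cong c β p q p≈q e with splitAt m₁ e
    ... | x , y , refl = begin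
      coeff (liftˡ c β p) (x Vec.++ y)       ≡⟨ coeff-liftˡ c β p x y ⟩
      coeff ((c * coeff p x , β) ∷ []) y     ≡⟨ cong (λ k → coeff ((c * k , β) ∷ []) y) (p≈q x) ⟩
      coeff ((c * coeff q x , β) ∷ []) y     ≡⟨ coeff-liftˡ c β q x y ⟨
      coeff (liftˡ c β q) (x Vec.++ y)       ∎

    liftʳ-cong : ∀ γ (p q : Pol m₂) → p ≈ q → liftʳ γ p ≈ liftʳ γ q
    liftʳ-cong γ p q p≈q e with splitAt m₁ e
    ... | x , y , refl = begin
      coeff (liftʳ γ p) (x Vec.++ y)      ≡⟨ coeff-liftʳ γ p x y ⟩
      coeff ((coeff p y , γ) ∷ []) x      ≡⟨ cong (λ k → coeff ((k , γ) ∷ []) x) (p≈q y) ⟩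
      coeff ((coeff q y , γ) ∷ []) x      ≡⟨ coeff-liftʳ γ q x y ⟨
      coeff (liftʳ γ q) (x Vec.++ y)      ∎

    liftˡ-*ₚ-embedˡ : ∀ c β (p g : Pol m₁) → liftˡ c β p *ₚ embedˡ m₂ g ≡ liftˡ c β (p *ₚ g)
    liftˡ-*ₚ-embedˡ c β []             g = refl
    liftˡ-*ₚ-embedˡ c β ((c' , e) ∷ p) g =
      trans (cong₂ _++_ (shift g) (liftˡ-*ₚ-embedˡ c β p g)) (sym (List.map-++ _ _ (p *ₚ g)))
      where
      shift : ∀ g → map (λ (c'' , e'') → ((c * c') * c'' , zipWith ℕ._+_ (e Vec.++ β) e'')) (embedˡ m₂ g)
                    ≡ liftˡ c β (map (λ (c'' , e'') → (c' * c'' , zipWith ℕ._+_ e e'')) g)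
      shift []               = refl
      shift ((c'' , e'') ∷ g) = cong₂ _∷_ (cong₂ _,_ (*-assoc c c' c'') (zipWith-+-++-0ʳ e e'' β)) (shift g)

    liftʳ-*ₚ-embedʳ : ∀ γ (q g : Pol m₂) → liftʳ γ q *ₚ embedʳ m₁ g ≡ liftʳ γ (q *ₚ g)
    liftʳ-*ₚ-embedʳ γ []            g = refl
    liftʳ-*ₚ-embedʳ γ ((c , e) ∷ q) g =
      trans (cong₂ _++_ (shift g) (liftʳ-*ₚ-embedʳ γ q g)) (sym (List.map-++ _ _ (q *ₚ g)))
      where
      shift : ∀ g → map (λ (c' , e') → (c * c' , zipWith ℕ._+_ (γ Vec.++ e) e')) (embedʳ m₁ g)
                    ≡ liftʳ γ (map (λ (c' , e') → (c * c' , zipWith ℕ._+_ e e')) g)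
      shift []              = refl
      shift ((c' , e') ∷ g) = cong₂ _∷_ (cong (c * c' ,_) (zipWith-+-++-0ˡ γ e e')) (shift g)

    eval-liftˡ : ∀ c β (p : Pol m₁) u w → eval (liftˡ c β p) (u Vec.++ w) ≡ eval p u * (c * evalMono β w)
    eval-liftˡ c β []             u w = sym (zeroˡ _)
    eval-liftˡ c β ((c' , e) ∷ p) u w = begin
      (c * c') * evalMono (e Vec.++ β) (u Vec.++ w) + eval (liftˡ c β p) (u Vec.++ w)
        ≡⟨ cong₂ _+_ (cong ((c * c') *_) (evalMono-++ e β u w)) (eval-liftˡ c β p u w) ⟩
      (c * c') * (evalMono e u * evalMono β w) + eval p u * (c * evalMono β w)
        ≡⟨ cong (_+ eval p u * (c * evalMono β w))
                (trans (cong (_* (evalMono e u * evalMono β w)) (*-comm c c')) (interchange c' c _ _)) ⟩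
      (c' * evalMono e u) * (c * evalMono β w) + eval p u * (c * evalMono β w)
        ≡⟨ distribʳ (c * evalMono β w) _ _ ⟨
      (c' * evalMono e u + eval p u) * (c * evalMono β w) ∎
      where open import Algebra.Properties.CommutativeSemigroup *-commutativeSemigroup using (interchange)

    _⊗_ : Pol m₁ → Pol m₂ → Pol (m₁ ℕ.+ m₂)
    A ⊗ B = concatMap (λ (c , β) → liftˡ c β A) B

    coeff-⊗ : ∀ A B x y → coeff (A ⊗ B) (x Vec.++ y) ≡ coeff A x * coeff B y
    coeff-⊗ A []            x y = sym (zeroʳ _)
    coeff-⊗ A ((c , β) ∷ B) x y with β ≟ₑ y
    ... | yes refl = begin
      coeff (liftˡ c β A ++ (A ⊗ B)) (x Vec.++ β)             ≡⟨ coeff-+ₚ (liftˡ c β A) (A ⊗ B) _ ⟩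
      coeff (liftˡ c β A) (x Vec.++ β) + coeff (A ⊗ B) (x Vec.++ β) ≡⟨ cong₂ _+_ (coeff-liftˡ-≡ c β A x) (coeff-⊗ A B x β) ⟩
      c * coeff A x + coeff A x * coeff B β                    ≡⟨ cong (_+ coeff A x * coeff B β) (*-comm c _) ⟩
      coeff A x * c + coeff A x * coeff B β                    ≡⟨ distribˡ _ c _ ⟨
      coeff A x * (c + coeff B β)                              ∎
    ... | no β≢y = begin
      coeff (liftˡ c β A ++ (A ⊗ B)) (x Vec.++ y)             ≡⟨ coeff-+ₚ (liftˡ c β A) (A ⊗ B) _ ⟩
      coeff (liftˡ c β A) (x Vec.++ y) + coeff (A ⊗ B) (x Vec.++ y) ≡⟨ cong₂ _+_ (coeff-liftˡ-≢ c A x β≢y) (coeff-⊗ A B x y) ⟩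
      0# + coeff A x * coeff B y                               ≡⟨ +-idˡ _ ⟩
      coeff A x * coeff B y                                    ∎

    eval-⊗ : ∀ A B u w → eval (A ⊗ B) (u Vec.++ w) ≡ eval A u * eval B w
    eval-⊗ A []            u w = sym (zeroʳ _)
    eval-⊗ A ((c , β) ∷ B) u w = begin
      eval (liftˡ c β A ++ (A ⊗ B)) (u Vec.++ w)                  ≡⟨ eval-+ₚ (liftˡ c β A) (A ⊗ B) _ ⟩
      eval (liftˡ c β A) (u Vec.++ w) + eval (A ⊗ B) (u Vec.++ w)  ≡⟨ cong₂ _+_ (eval-liftˡ c β A u w) (eval-⊗ A B u w) ⟩
      eval A u * (c * evalMono β w) + eval A u * eval B w         ≡⟨ distribˡ (eval A u) _ _ ⟨
      eval A u * (c * evalMono β w + eval B w)                     ∎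

    DegLe-⊗ : ∀ A B {a b} → DegLe A a → DegLe B b → DegLe (A ⊗ B) (a ℕ.+ b)
    DegLe-⊗ A B {a} {b} A≤a B≤b e a+b<e with splitAt m₁ e
    ... | x , y , refl with +-<⇒<⊎< (subst (a ℕ.+ b <_) (Vec.sum-++ x) a+b<e)
    ...   | inj₁ a<x = trans (coeff-⊗ A B x y) (trans (cong (_* _) (A≤a x a<x)) (zeroˡ _))
    ...   | inj₂ b<y = trans (coeff-⊗ A B x y) (trans (cong (_ *_) (B≤b y b<y)) (zeroʳ _))

  module _ {m₁ m₂ : ℕ} {P : Point (m₁ ℕ.+ m₂) → Set} where

    All-×ˢ⁺ : ∀ (V₁ : Subset m₁) (V₂ : Subset m₂) → (∀ {u w} → u ∈ V₁ → w ∈ V₂ → P (u Vec.++ w)) →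
              All P (V₁ ×ˢ V₂)
    All-×ˢ⁺ []       V₂ P-uw = []
    All-×ˢ⁺ (u ∷ V₁) V₂ P-uw =
      All.++⁺ (All.map⁺ (All.tabulate (P-uw (here refl)))) (All-×ˢ⁺ V₁ V₂ (P-uw ∘ there))

    All-×ˢ⁻ : ∀ (V₁ : Subset m₁) (V₂ : Subset m₂) → All P (V₁ ×ˢ V₂) →
              ∀ {u w} → u ∈ V₁ → w ∈ V₂ → P (u Vec.++ w)
    All-×ˢ⁻ (u ∷ V₁) V₂ P-V (here refl) w∈V₂ =
      All.lookup (All.map⁻ (All.++⁻ˡ (map (u Vec.++_) V₂) P-V)) w∈V₂
    All-×ˢ⁻ (u ∷ V₁) V₂ P-V (there u∈V₁) w∈V₂ =
      All-×ˢ⁻ V₁ V₂ (All.++⁻ʳ (map (u Vec.++_) V₂) P-V) u∈V₁ w∈V₂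

module Combinations (F : FiniteField) where
  open FiniteField F
  open Poly F
  open FieldProperties F
  open PolynomialProperties F

  -- the conclusion of IsGröbnerGenSet, as a record so that G, d and P can be inferred from its type
  record Combination {m} (G : List (Pol m)) (d : ℕ) (P : Pol m) : Set where
    constructor combination
    field
      multiplier : Fin (length G) → Pol m
      represents : P ≈ combo G multiplier
      bounded    : ∀ i → DegLe (multiplier i *ₚ lookup G i) d

  module _ {m : ℕ} where

    *ₚ-distribʳ : ∀ (p q g : Pol m) → (p +ₚ q) *ₚ g ≡ (p *ₚ g) +ₚ (q *ₚ g)
    *ₚ-distribʳ p q g = List.concatMap-++ _ p q

    combo-+ₚ : ∀ (G : List (Pol m)) h₁ h₂ → combo G (λ i → h₁ i +ₚ h₂ i) ≈ (combo G h₁ +ₚ combo G h₂)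
    combo-+ₚ []      h₁ h₂ e = refl
    combo-+ₚ (g ∷ G) h₁ h₂ e = begin
      coeff (((h₁ zero +ₚ h₂ zero) *ₚ g) +ₚ combo G (λ i → h₁ (suc i) +ₚ h₂ (suc i))) e
        ≡⟨ cong (λ p → coeff (p +ₚ _) e) (*ₚ-distribʳ (h₁ zero) (h₂ zero) g) ⟩
      coeff (((h₁ zero *ₚ g) +ₚ (h₂ zero *ₚ g)) +ₚ combo G (λ i → h₁ (suc i) +ₚ h₂ (suc i))) e
        ≡⟨ +ₚ-cong ((h₁ zero *ₚ g) +ₚ (h₂ zero *ₚ g)) ((h₁ zero *ₚ g) +ₚ (h₂ zero *ₚ g))
                   (combo G (λ i → h₁ (suc i) +ₚ h₂ (suc i))) (combo G (h₁ ∘ suc) +ₚ combo G (h₂ ∘ suc))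
                   (λ _ → refl) (combo-+ₚ G (h₁ ∘ suc) (h₂ ∘ suc)) e ⟩
      coeff (((h₁ zero *ₚ g) +ₚ (h₂ zero *ₚ g)) +ₚ (combo G (h₁ ∘ suc) +ₚ combo G (h₂ ∘ suc))) e
        ≡⟨ +ₚ-interchange (h₁ zero *ₚ g) (h₂ zero *ₚ g) (combo G (h₁ ∘ suc)) (combo G (h₂ ∘ suc)) e ⟩
      coeff (combo (g ∷ G) h₁ +ₚ combo (g ∷ G) h₂) e ∎
      where open ≡-Reasoning

    combo-0ₚ : ∀ (G : List (Pol m)) → combo G (λ _ → 0ₚ) ≡ 0ₚ
    combo-0ₚ []      = refl
    combo-0ₚ (g ∷ G) = combo-0ₚ G

    combination-0ₚ : ∀ {G d} → Combination G d (0ₚ {m})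
    combination-0ₚ {G} = combination (λ _ → 0ₚ) (λ e → cong (λ p → coeff p e) (sym (combo-0ₚ G))) (λ _ → DegLe-0ₚ)

    combination-cong : ∀ {G d} {P Q : Pol m} → P ≈ Q → Combination G d Q → Combination G d P
    combination-cong P≈Q (combination h Q≈ deg) = combination h (λ e → trans (P≈Q e) (Q≈ e)) deg

    combination-mono : ∀ {G d d'} {P : Pol m} → d ≤ d' → Combination G d P → Combination G d' P
    combination-mono {G} d≤d' (combination h P≈ deg) = combination h P≈ (λ i → DegLe-mono (h i *ₚ lookup G i) d≤d' (deg i))

    combination-+ₚ : ∀ {G d} {P Q : Pol m} → Combination G d P → Combination G d Q → Combination G d (P +ₚ Q)
    combination-+ₚ {G} {d} {P} {Q} (combination h₁ P≈ deg₁) (combination h₂ Q≈ deg₂) = combination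
      (λ i → h₁ i +ₚ h₂ i)
      (λ e → trans (+ₚ-cong P (combo G h₁) Q (combo G h₂) P≈ Q≈ e) (sym (combo-+ₚ G h₁ h₂ e)))
      (λ i → subst (λ p → DegLe p d) (sym (*ₚ-distribʳ (h₁ i) (h₂ i) (lookup G i)))
                   (DegLe-+ₚ (h₁ i *ₚ lookup G i) (h₂ i *ₚ lookup G i) (deg₁ i) (deg₂ i)))

    combination-concatMap : ∀ {a} {A : Set a} {G d} (f : A → Pol m) xs →
                            (∀ {x} → x ∈ xs → Combination G d (f x)) → Combination G d (concatMap f xs)
    combination-concatMap f []       comb = combination-0ₚ
    combination-concatMap f (x ∷ xs) comb =
      combination-+ₚ (comb (here refl)) (combination-concatMap f xs (comb ∘ there))

    padʳ : ∀ (G G' : List (Pol m)) → (Fin (length G) → Pol m) → Fin (length (G ++ G')) → Pol m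
    padʳ []      G' h i       = 0ₚ
    padʳ (g ∷ G) G' h zero    = h zero
    padʳ (g ∷ G) G' h (suc i) = padʳ G G' (h ∘ suc) i

    padˡ : ∀ (G G' : List (Pol m)) → (Fin (length G') → Pol m) → Fin (length (G ++ G')) → Pol m
    padˡ []      G' h         = h
    padˡ (g ∷ G) G' h zero    = 0ₚ
    padˡ (g ∷ G) G' h (suc i) = padˡ G G' h i

    combination-++ˡ : ∀ {G d} G' {P : Pol m} → Combination G d P → Combination (G ++ G') d P
    combination-++ˡ {G} {d} G' (combination h P≈ deg) =
      combination (padʳ G G' h) (λ e → trans (P≈ e) (combo-padʳ G h e)) (deg-padʳ G h deg)
      where
      combo-padʳ : ∀ G h → combo G h ≈ combo (G ++ G') (padʳ G G' h)
      combo-padʳ []      h e = sym (cong (λ p → coeff p e) (combo-0ₚ G'))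
      combo-padʳ (g ∷ G) h e = +ₚ-cong (h zero *ₚ g) (h zero *ₚ g) _ (combo (G ++ G') (padʳ G G' (h ∘ suc)))
                                        (λ _ → refl) (combo-padʳ G (h ∘ suc)) e
      deg-padʳ : ∀ G h → (∀ i → DegLe (h i *ₚ lookup G i) d) → ∀ i → DegLe (padʳ G G' h i *ₚ lookup (G ++ G') i) d
      deg-padʳ []      h deg i       = DegLe-0ₚ
      deg-padʳ (g ∷ G) h deg zero    = deg zero
      deg-padʳ (g ∷ G) h deg (suc i) = deg-padʳ G (h ∘ suc) (deg ∘ suc) i

    combination-++ʳ : ∀ G {G' d} {P : Pol m} → Combination G' d P → Combination (G ++ G') d P
    combination-++ʳ G {G'} {d} (combination h P≈ deg) =
      combination (padˡ G G' h) (λ e → trans (P≈ e) (combo-padˡ G e)) (deg-padˡ G)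
      where
      combo-padˡ : ∀ G → combo G' h ≈ combo (G ++ G') (padˡ G G' h)
      combo-padˡ []      e = refl
      combo-padˡ (g ∷ G) e = combo-padˡ G e
      deg-padˡ : ∀ G i → DegLe (padˡ G G' h i *ₚ lookup (G ++ G') i) d
      deg-padˡ []      i       = deg i
      deg-padˡ (g ∷ G) zero    = DegLe-0ₚ
      deg-padˡ (g ∷ G) (suc i) = deg-padˡ G i

  combination-map : ∀ {m n} (τ : Carrier × Exp m → Carrier × Exp n) (φ : Pol m → Pol n) {G k k' P} →
    (∀ p q → p ≈ q → map τ p ≈ map τ q) →
    (∀ p g → map τ p *ₚ φ g ≡ map τ (p *ₚ g)) →
    (∀ p → DegLe p k → DegLe (map τ p) k') →
    Combination G k P → Combination (map φ G) k' (map τ P)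
  combination-map {m} {n} τ φ {G} {k} {k'} {P} τ-cong τ-*ₚ τ-deg (combination h P≈ deg) = combination
    (lifted G h)
    (λ e → trans (τ-cong P (combo G h) P≈ e) (cong (λ p → coeff p e) (sym (combo-lifted G h))))
    (deg-lifted G h deg)
    where
    lifted : ∀ G → (Fin (length G) → Pol m) → Fin (length (map φ G)) → Pol n
    lifted (g ∷ G) h zero    = map τ (h zero)
    lifted (g ∷ G) h (suc i) = lifted G (h ∘ suc) i
    combo-lifted : ∀ G h → combo (map φ G) (lifted G h) ≡ map τ (combo G h)
    combo-lifted []      h = refl
    combo-lifted (g ∷ G) h =
      trans (cong₂ _++_ (τ-*ₚ (h zero) g) (combo-lifted G (h ∘ suc))) (sym (List.map-++ τ (h zero *ₚ g) (combo G (h ∘ suc))))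
    deg-lifted : ∀ G h → (∀ i → DegLe (h i *ₚ lookup G i) k) → ∀ i → DegLe (lifted G h i *ₚ lookup (map φ G) i) k'
    deg-lifted (g ∷ G) h deg zero    = subst (λ p → DegLe p k') (sym (τ-*ₚ (h zero) g)) (τ-deg (h zero *ₚ g) (deg zero))
    deg-lifted (g ∷ G) h deg (suc i) = deg-lifted G (h ∘ suc) (deg ∘ suc) i

module StandardMonomials (F : FiniteField) {m : ℕ} (V : Poly.Subset F m) where
  open FiniteField F
  open Poly F
  open FieldProperties F
  open PolynomialProperties F
  open import Algebra.Properties.AbelianGroup +-abelianGroup using (x∙y⁻¹≈ε⇒x≈y; x≈y⇒x∙y⁻¹≈ε)
  open import Algebra.Properties.Ring ring using (-1*x≈-x)
  open ≡-Reasoning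

  Basis : Set
  Basis = List (Point m × Pol m)

  -- Newton-style interpolation of f through the pivots of B
  project : Basis → (Point m → Carrier) → Pol m
  project []            f = 0ₚ
  project ((u , b) ∷ B) f = project B f +ₚ scale (f u + - eval (project B f) u) b

  Reproduces : Basis → (Point m → Carrier) → Set
  Reproduces B f = ∀ {u} → u ∈ V → eval (project B f) u ≡ f u

  eval-project-∷ : ∀ u b B (f : Point m → Carrier) w →
    eval (project ((u , b) ∷ B) f) w ≡ eval (project B f) w + (f u + - eval (project B f) u) * eval b w
  eval-project-∷ u b B f w =
    trans (eval-+ₚ (project B f) _ w) (cong (eval (project B f) w +_) (eval-scale _ b w))

  project-+ : ∀ B (f g : Point m → Carrier) w →
              eval (project B (λ v → f v + g v)) w ≡ eval (project B f) w + eval (project B g) w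
  project-+ []            f g w = sym (+-idˡ 0#)
  project-+ ((u , b) ∷ B) f g w = begin
    eval (project ((u , b) ∷ B) f+g) w
      ≡⟨ eval-project-∷ u b B f+g w ⟩
    eval (project B f+g) w + (f u + g u + - eval (project B f+g) u) * eval b w
      ≡⟨ cong₂ (λ x y → x + (f u + g u + - y) * eval b w) (project-+ B f g w) (project-+ B f g u) ⟩
    (Pf w + Pg w) + (f u + g u + - (Pf u + Pg u)) * eval b w
      ≡⟨ cong (λ x → (Pf w + Pg w) + x * eval b w) coefficient ⟩
    (Pf w + Pg w) + ((f u + - Pf u) + (g u + - Pg u)) * eval b w
      ≡⟨ cong ((Pf w + Pg w) +_) (distribʳ (eval b w) _ _) ⟩
    (Pf w + Pg w) + ((f u + - Pf u) * eval b w + (g u + - Pg u) * eval b w)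
      ≡⟨ interchange _ _ _ _ ⟩
    (Pf w + (f u + - Pf u) * eval b w) + (Pg w + (g u + - Pg u) * eval b w)
      ≡⟨ cong₂ _+_ (eval-project-∷ u b B f w) (eval-project-∷ u b B g w) ⟨
    eval (project ((u , b) ∷ B) f) w + eval (project ((u , b) ∷ B) g) w
      ∎
    where
    open import Algebra.Properties.CommutativeSemigroup +-commutativeSemigroup using (interchange)
    open import Algebra.Properties.AbelianGroup +-abelianGroup using (⁻¹-∙-comm)
    f+g = λ v → f v + g v
    Pf = eval (project B f)
    Pg = eval (project B g)
    coefficient : f u + g u + - (Pf u + Pg u) ≡ (f u + - Pf u) + (g u + - Pg u)
    coefficient = trans (cong (f u + g u +_) (sym (⁻¹-∙-comm (Pf u) (Pg u)))) (interchange _ _ _ _)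

  project-scale : ∀ B a (f : Point m → Carrier) w → eval (project B (λ v → a * f v)) w ≡ a * eval (project B f) w
  project-scale []            a f w = sym (zeroʳ a)
  project-scale ((u , b) ∷ B) a f w = begin
    eval (project ((u , b) ∷ B) af) w
      ≡⟨ eval-project-∷ u b B af w ⟩
    eval (project B af) w + (a * f u + - eval (project B af) u) * eval b w
      ≡⟨ cong₂ (λ x y → x + (a * f u + - y) * eval b w) (project-scale B a f w) (project-scale B a f u) ⟩
    a * Pf w + (a * f u + - (a * Pf u)) * eval b w
      ≡⟨ cong (λ x → a * Pf w + (a * f u + x) * eval b w) (-‿distribʳ-* a (Pf u)) ⟩
    a * Pf w + (a * f u + a * - Pf u) * eval b w
      ≡⟨ cong (λ x → a * Pf w + x * eval b w) (distribˡ a (f u) (- Pf u)) ⟨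
    a * Pf w + (a * (f u + - Pf u)) * eval b w
      ≡⟨ cong (a * Pf w +_) (*-assoc a _ _) ⟩
    a * Pf w + a * ((f u + - Pf u) * eval b w)
      ≡⟨ distribˡ a _ _ ⟨
    a * (Pf w + (f u + - Pf u) * eval b w)
      ≡⟨ cong (a *_) (eval-project-∷ u b B f w) ⟨
    a * eval (project ((u , b) ∷ B) f) w
      ∎
    where
    open import Algebra.Properties.Ring ring using (-‿distribʳ-*)
    af = λ v → a * f v
    Pf = eval (project B f)

  project-0 : ∀ B w → eval (project B (λ _ → 0#)) w ≡ 0#
  project-0 []            w = refl
  project-0 ((u , b) ∷ B) w = begin
    eval (project ((u , b) ∷ B) (λ _ → 0#)) w
      ≡⟨ eval-project-∷ u b B (λ _ → 0#) w ⟩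
    eval (project B (λ _ → 0#)) w + (0# + - eval (project B (λ _ → 0#)) u) * eval b w
      ≡⟨ cong₂ (λ x y → x + (0# + - y) * eval b w) (project-0 B w) (project-0 B u) ⟩
    0# + (0# + - 0#) * eval b w
      ≡⟨ cong (λ x → 0# + x * eval b w) (-‿inverseʳ 0#) ⟩
    0# + 0# * eval b w
      ≡⟨ trans (+-idˡ _) (zeroˡ _) ⟩
    0#
      ∎

  project-cong : ∀ B {f g : Point m → Carrier} → All (λ (u , _) → f u ≡ g u) B → project B f ≡ project B g
  project-cong []            []            = refl
  project-cong ((u , b) ∷ B) (fu≡gu ∷ f≡g) rewrite project-cong B f≡g | fu≡gu = refl

  reproduces-supported : ∀ B {S} → (∀ {γ} → γ ∈ S → Reproduces B (evalMono γ)) →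
                         ∀ q → SupportedIn S q → Reproduces B (eval q)
  reproduces-supported B rep []            []            {u} _   = project-0 B u
  reproduces-supported B rep ((c , γ) ∷ q) (γ∈S ∷ q∈S) {u} u∈V = begin
    eval (project B (λ v → c * evalMono γ v + eval q v)) u
      ≡⟨ project-+ B (λ v → c * evalMono γ v) (eval q) u ⟩
    eval (project B (λ v → c * evalMono γ v)) u + eval (project B (eval q)) u
      ≡⟨ cong (_+ _) (project-scale B c (evalMono γ) u) ⟩
    c * eval (project B (evalMono γ)) u + eval (project B (eval q)) u
      ≡⟨ cong₂ (λ x y → c * x + y) (rep γ∈S u∈V) (reproduces-supported B rep q q∈S u∈V) ⟩
    c * evalMono γ u + eval q u
      ∎

  DegLe-project : ∀ B {k} (f : Point m → Carrier) → All (λ (_ , b) → DegLe b k) B → DegLe (project B f) k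
  DegLe-project []            f []          = DegLe-0ₚ
  DegLe-project ((u , b) ∷ B) f (b≤k ∷ B≤k) =
    DegLe-+ₚ (project B f) _ (DegLe-project B f B≤k) (DegLe-scale _ b b≤k)

  SupportedIn-project : ∀ B {S} (f : Point m → Carrier) → All (λ (_ , b) → SupportedIn S b) B →
                        SupportedIn S (project B f)
  SupportedIn-project []            f []          = []
  SupportedIn-project ((u , b) ∷ B) f (b⊆S ∷ B⊆S) =
    All.++⁺ (SupportedIn-project B f B⊆S) (SupportedIn-scale _ b⊆S)

  residual : Basis → Exp m → Point m → Carrier
  residual B α u = evalMono α u + - eval (project B (evalMono α)) u

  residualPol : Basis → Exp m → Pol m
  residualPol B α = (1# , α) ∷ scale (- 1#) (project B (evalMono α))

  eval-residualPol : ∀ B α v → eval (residualPol B α) v ≡ residual B α v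
  eval-residualPol B α v =
    cong₂ _+_ (*-idˡ _) (trans (eval-scale (- 1#) (project B (evalMono α)) v) (-1*x≈-x _))

  Resolved : Basis → Exp m → Set
  Resolved B α = All (λ u → residual B α u ≡ 0#) V

  pivot : ∀ B α → ¬ Resolved B α → Σ (Point m) λ u → u ∈ V × residual B α u ≢ 0#
  pivot B α unresolved = find (All.¬All⇒Any¬ (λ u → residual B α u ≟ 0#) V unresolved)

  -- one step of Gaussian elimination: x^α, unless already interpolated, contributes a new pivot
  extend : ∀ α (st : Basis × List (Exp m)) → Dec (Resolved (proj₁ st) α) → Basis × List (Exp m)
  extend α st      (yes _)          = st
  extend α (B , S) (no unresolved) =
    let (u₀ , _ , r≢0) = pivot B α unresolved
    in ((u₀ , scale ((residual B α u₀ ⁻¹) r≢0) (residualPol B α)) ∷ B) , α ∷ S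

  eliminate : List (Exp m) → Basis × List (Exp m)
  eliminate []      = [] , []
  eliminate (α ∷ L) = extend α (eliminate L) (All.all? (λ u → residual (proj₁ (eliminate L)) α u ≟ 0#) V)

  record Invariant (L : List (Exp m)) (st : Basis × List (Exp m)) : Set where
    field
      pivots-in-V   : All (λ (u , _) → u ∈ V) (proj₁ st)
      reproduces    : ∀ {γ} → γ ∈ L → Reproduces (proj₁ st) (evalMono γ)
      standard-in-L : All (_∈ L) (proj₂ st)
      basis-deg     : ∀ {k} → All (λ γ → totalDeg γ ≤ k) L → All (λ (_ , b) → DegLe b k) (proj₁ st)
      reduction-deg : ∀ {γ} → γ ∈ L → DegLe (project (proj₁ st) (evalMono γ)) (totalDeg γ)
      basis-supp    : All (λ (_ , b) → SupportedIn (proj₂ st) b) (proj₁ st)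
      independent   : ∀ q → SupportedIn (proj₂ st) q → 𝕀 V q → q ≈ 0ₚ

  open Invariant

  independence-extends : ∀ {L B S α} → Invariant L (B , S) → ¬ Resolved B α →
                         ∀ q → SupportedIn (α ∷ S) q → 𝕀 V q → q ≈ 0ₚ
  independence-extends {L} {B} {S} {α} I unresolved q q⊆α∷S q∈𝕀 with coeff q α ≟ 0#
  ... | yes cα≡0 = q≈0
    where
    R = remove α q
    R∈𝕀 : 𝕀 V R
    R∈𝕀 = All.map (λ {v} qv≡0 → begin
      eval R v                             ≡⟨ +-idˡ _ ⟨
      0# + eval R v                        ≡⟨ cong (_+ eval R v) (trans (sym (zeroˡ _)) (cong (_* evalMono α v) (sym cα≡0))) ⟩
      coeff q α * evalMono α v + eval R v  ≡⟨ eval-remove α q v ⟨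
      eval q v                             ≡⟨ qv≡0 ⟩
      0#                                   ∎) q∈𝕀
    R≈0 : R ≈ 0ₚ
    R≈0 = independent I R (SupportedIn-remove q⊆α∷S) R∈𝕀
    q≈0 : q ≈ 0ₚ
    q≈0 e with e ≟ₑ α
    ... | yes refl = cα≡0
    ... | no e≢α   = trans (sym (coeff-filter-accept _ q e≢α)) (R≈0 e)
  ... | no cα≢0 = contradiction resolved unresolved
    where
    open import Algebra.Properties.AbelianGroup +-abelianGroup using (inverseˡ-unique)
    c = coeff q α
    R = remove α q
    a = (c ⁻¹) cα≢0 * - 1#
    -- a nonzero coefficient at α would make x^α agree on V with a combination of the old standard
    -- monomials, which the basis already interpolates
    x^α≡aR : ∀ {v} → v ∈ V → evalMono α v ≡ a * eval R v
    x^α≡aR {v} v∈V = begin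
      evalMono α v                      ≡⟨ *-inverse-cancelʳ c cα≢0 _ ⟨
      (c ⁻¹) cα≢0 * (c * evalMono α v)  ≡⟨ cong ((c ⁻¹) cα≢0 *_) cx≡-R ⟩
      (c ⁻¹) cα≢0 * - eval R v          ≡⟨ cong ((c ⁻¹) cα≢0 *_) (-1*x≈-x _) ⟨
      (c ⁻¹) cα≢0 * (- 1# * eval R v)   ≡⟨ *-assoc _ _ _ ⟨
      a * eval R v                      ∎
      where
      cx≡-R : c * evalMono α v ≡ - eval R v
      cx≡-R = inverseˡ-unique _ _ (trans (sym (eval-remove α q v)) (All.lookup q∈𝕀 v∈V))
    resolved : Resolved B α
    resolved = All.tabulate λ {u} u∈V → x≈y⇒x∙y⁻¹≈ε (sym (begin
      eval (project B (evalMono α)) u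
        ≡⟨ cong (λ P → eval P u) (project-cong B (All.map x^α≡aR (pivots-in-V I))) ⟩
      eval (project B (λ v → a * eval R v)) u
        ≡⟨ project-scale B a (eval R) u ⟩
      a * eval (project B (eval R)) u
        ≡⟨ cong (a *_) (reproduces-supported B (reproduces I ∘ All.lookup (standard-in-L I)) R (SupportedIn-remove q⊆α∷S) u∈V) ⟩
      a * eval R u
        ≡⟨ x^α≡aR u∈V ⟨
      evalMono α u
        ∎))

  module NewPivot {L B S α} (I : Invariant L (B , S)) (L≤α : All (λ γ → totalDeg γ ≤ totalDeg α) L)
                  (unresolved : ¬ Resolved B α) {u₀} (u₀∈V : u₀ ∈ V) (r≢0 : residual B α u₀ ≢ 0#) where
    r = residual B α u₀
    k = (r ⁻¹) r≢0
    b = scale k (residualPol B α)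
    B′ = (u₀ , b) ∷ B

    eval-b : ∀ v → eval b v ≡ k * residual B α v
    eval-b v = trans (eval-scale k (residualPol B α) v) (cong (k *_) (eval-residualPol B α v))

    b-deg : ∀ {d} → totalDeg α ≤ d → All (λ γ → totalDeg γ ≤ d) L → DegLe b d
    b-deg α≤d L≤d = DegLe-scale k (residualPol B α)
      (DegLe-∷ 1# α _ α≤d (DegLe-scale (- 1#) (project B (evalMono α)) (DegLe-project B _ (basis-deg I L≤d))))

    b⊆α∷S : SupportedIn (α ∷ S) b
    b⊆α∷S = SupportedIn-scale k (here refl ∷ SupportedIn-scale (- 1#)
              (SupportedIn-project B _ (All.map (All.map there) (basis-supp I))))

    -- the new pivot does not disturb monomials that were already interpolated
    coefficient≡0 : ∀ {γ} → γ ∈ L → evalMono γ u₀ + - eval (project B (evalMono γ)) u₀ ≡ 0#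
    coefficient≡0 γ∈L = x≈y⇒x∙y⁻¹≈ε (sym (reproduces I γ∈L u₀∈V))

    reproduces′ : ∀ {γ} → γ ∈ α ∷ L → Reproduces B′ (evalMono γ)
    reproduces′ (here refl) {v} v∈V = begin
      eval (project B′ (evalMono α)) v  ≡⟨ eval-project-∷ u₀ b B (evalMono α) v ⟩
      P v + r * eval b v                ≡⟨ cong (λ x → P v + r * x) (eval-b v) ⟩
      P v + r * (k * residual B α v)    ≡⟨ cong (P v +_) (*-inverse-cancelˡ r r≢0 _) ⟩
      P v + (evalMono α v + - P v)      ≡⟨ x∙yz≈y∙xz _ _ _ ⟩
      evalMono α v + (P v + - P v)      ≡⟨ cong (evalMono α v +_) (-‿inverseʳ _) ⟩
      evalMono α v + 0#                 ≡⟨ +-identityʳ _ ⟩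
      evalMono α v                      ∎
      where
      open import Algebra.Properties.CommutativeSemigroup +-commutativeSemigroup using (x∙yz≈y∙xz)
      P = eval (project B (evalMono α))
    reproduces′ {γ} (there γ∈L) {v} v∈V = begin
      eval (project B′ (evalMono γ)) v                ≡⟨ eval-project-∷ u₀ b B (evalMono γ) v ⟩
      P v + (evalMono γ u₀ + - P u₀) * eval b v       ≡⟨ cong (λ x → P v + x * eval b v) (coefficient≡0 γ∈L) ⟩
      P v + 0# * eval b v                             ≡⟨ cong (P v +_) (zeroˡ _) ⟩
      P v + 0#                                        ≡⟨ +-identityʳ _ ⟩
      P v                                             ≡⟨ reproduces I γ∈L v∈V ⟩
      evalMono γ v                                    ∎
      where P = eval (project B (evalMono γ))

    reduction-deg′ : ∀ {γ} → γ ∈ α ∷ L → DegLe (project B′ (evalMono γ)) (totalDeg γ)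
    reduction-deg′ (here refl) =
      DegLe-+ₚ (project B (evalMono α)) _ (DegLe-project B _ (basis-deg I L≤α)) (DegLe-scale r b (b-deg ℕ.≤-refl L≤α))
    reduction-deg′ {γ} (there γ∈L) =
      DegLe-+ₚ (project B (evalMono γ)) _ (reduction-deg I γ∈L)
               (DegLe-cong (scale _ b) 0ₚ (scale-zero b (coefficient≡0 γ∈L)) DegLe-0ₚ)

    invariant : Invariant (α ∷ L) (B′ , α ∷ S)
    invariant = record
      { pivots-in-V   = u₀∈V ∷ pivots-in-V I
      ; reproduces    = reproduces′
      ; standard-in-L = here refl ∷ All.map there (standard-in-L I)
      ; basis-deg     = λ { (α≤k ∷ L≤k) → b-deg α≤k L≤k ∷ basis-deg I L≤k }
      ; reduction-deg = reduction-deg′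
      ; basis-supp    = b⊆α∷S ∷ All.map (All.map there) (basis-supp I)
      ; independent   = independence-extends I unresolved
      }

  extend-invariant : ∀ {L B S} α → Invariant L (B , S) → All (λ γ → totalDeg γ ≤ totalDeg α) L →
                     (resolved? : Dec (Resolved B α)) → Invariant (α ∷ L) (extend α (B , S) resolved?)
  extend-invariant {L} {B} {S} α I L≤α (yes resolved) = record
    { pivots-in-V   = pivots-in-V I
    ; reproduces    = reproduces′
    ; standard-in-L = All.map there (standard-in-L I)
    ; basis-deg     = λ { (_ ∷ L≤k) → basis-deg I L≤k }
    ; reduction-deg = reduction-deg′
    ; basis-supp    = basis-supp I
    ; independent   = independent I
    }
    where
    reproduces′ : ∀ {γ} → γ ∈ α ∷ L → Reproduces B (evalMono γ)
    reproduces′ (here refl) u∈V = sym (x∙y⁻¹≈ε⇒x≈y _ _ (All.lookup resolved u∈V))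
    reproduces′ (there γ∈L)     = reproduces I γ∈L
    reduction-deg′ : ∀ {γ} → γ ∈ α ∷ L → DegLe (project B (evalMono γ)) (totalDeg γ)
    reduction-deg′ (here refl) = DegLe-project B _ (basis-deg I L≤α)
    reduction-deg′ (there γ∈L) = reduction-deg I γ∈L
  extend-invariant {B = B} α I L≤α (no unresolved) with pivot B α unresolved
  ... | u₀ , u₀∈V , r≢0 = NewPivot.invariant I L≤α unresolved u₀∈V r≢0

  eliminate-invariant : ∀ L → AllPairs (λ α γ → totalDeg γ ≤ totalDeg α) L → Invariant L (eliminate L)
  eliminate-invariant []      []                = record
    { pivots-in-V   = []
    ; reproduces    = λ ()
    ; standard-in-L = []
    ; basis-deg     = λ _ → []
    ; reduction-deg = λ ()
    ; basis-supp    = []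
    ; independent   = λ { [] _ _ _ → refl ; (_ ∷ _) (() ∷ _) _ }
    }
  eliminate-invariant (α ∷ L) (L≤α ∷ sorted) = extend-invariant α (eliminate-invariant L sorted) L≤α _

  record Reduction (L : List (Exp m)) : Set where
    field
      standard         : List (Exp m)
      reduce           : Exp m → Pol m
      reduce-agrees    : ∀ {γ} → γ ∈ L → ∀ {u} → u ∈ V → eval (reduce γ) u ≡ evalMono γ u
      reduce-deg       : ∀ {γ} → γ ∈ L → DegLe (reduce γ) (totalDeg γ)
      reduce-supported : ∀ γ → SupportedIn standard (reduce γ)
      independent      : ∀ q → SupportedIn standard q → 𝕀 V q → q ≈ 0ₚ

  -- Eliminating the monomials in order of increasing degree keeps every reduction within its degree.
  reduction : ∀ L → Reduction L
  reduction L = record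
    { standard         = proj₂ (eliminate (sort L))
    ; reduce           = λ γ → project (proj₁ (eliminate (sort L))) (evalMono γ)
    ; reduce-agrees    = reproduces I ∘ ∈-sort
    ; reduce-deg       = reduction-deg I ∘ ∈-sort
    ; reduce-supported = λ γ → SupportedIn-project _ (evalMono γ) (basis-supp I)
    ; independent      = independent I
    }
    where
    open import Data.List.Sort (On.decTotalOrder (Flip.decTotalOrder ℕ.≤-decTotalOrder) totalDeg)
      using (sort; sort-↭; sort-↗)
    I : Invariant (sort L) (eliminate (sort L))
    I = eliminate-invariant (sort L) (Linked⇒AllPairs (λ p q → ℕ.≤-trans q p) (sort-↗ L))
    ∈-sort : ∀ {γ} → γ ∈ L → γ ∈ sort L
    ∈-sort = ∈-resp-↭ (↭-sym (sort-↭ L))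

module ProductExtension (F : FiniteField) where
  open FiniteField F
  open Poly F
  open FieldProperties F
  open PolynomialProperties F
  open ≡-Reasoning

  module _ {m : ℕ} where

    _≟ₚ_ : DecidableEquality (Point m)
    _≟ₚ_ = Vec.≡-dec _≟_

    δ : Point m → Point m → Carrier
    δ u₀ u with u₀ ≟ₚ u
    ... | yes _ = 1#
    ... | no _  = 0#

    ∑-δ : ∀ {U} → Unique U → ∀ (c : Point m → Carrier) {u} → u ∈ U → ∑ U (λ u₀ → δ u₀ u * c u₀) ≡ c u
    ∑-δ unique c {u} u∈U = trans (∑-unique unique u∈U off-u) on-u
      where
      off-u : ∀ {u₀} → u₀ ≢ u → δ u₀ u * c u₀ ≡ 0#
      off-u {u₀} u₀≢u with u₀ ≟ₚ u
      ... | yes u₀≡u = contradiction u₀≡u u₀≢u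
      ... | no _     = zeroˡ _
      on-u : δ u u * c u ≡ c u
      on-u with u ≟ₚ u
      ... | yes _   = *-idˡ _
      ... | no u≢u  = contradiction refl u≢u

  product-extends : ∀ {m₁ m₂} {V₁ : Subset m₁} {V₂ : Subset m₂} {d₁ d₂} →
    ExtendsWithDeg V₁ d₁ → ExtendsWithDeg V₂ d₂ → ExtendsWithDeg (V₁ ×ˢ V₂) (d₁ ℕ.+ d₂)
  product-extends {m₁} {m₂} {V₁} {V₂} {d₁} {d₂} E₁ E₂ f =
    P , DegLe-concatMap (λ u₀ → A u₀ ⊗ B u₀) U (λ {u₀} _ → DegLe-⊗ (A u₀) (B u₀) (A-deg u₀) (B-deg u₀)) ,
    All-×ˢ⁺ V₁ V₂ P-agrees
    where
    U = deduplicate _≟ₚ_ V₁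
    A : Point m₁ → Pol m₁
    A u₀ = proj₁ (E₁ (δ u₀))
    A-deg : ∀ u₀ → DegLe (A u₀) d₁
    A-deg u₀ = proj₁ (proj₂ (E₁ (δ u₀)))
    B : Point m₁ → Pol m₂
    B u₀ = proj₁ (E₂ (λ w → f (u₀ Vec.++ w)))
    B-deg : ∀ u₀ → DegLe (B u₀) d₂
    B-deg u₀ = proj₁ (proj₂ (E₂ (λ w → f (u₀ Vec.++ w))))
    A-agrees : ∀ u₀ {u} → u ∈ V₁ → eval (A u₀) u ≡ δ u₀ u
    A-agrees u₀ = All.lookup (proj₂ (proj₂ (E₁ (δ u₀))))
    B-agrees : ∀ u₀ {w} → w ∈ V₂ → eval (B u₀) w ≡ f (u₀ Vec.++ w)
    B-agrees u₀ = All.lookup (proj₂ (proj₂ (E₂ (λ w → f (u₀ Vec.++ w)))))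
    P : Pol (m₁ ℕ.+ m₂)
    P = concatMap (λ u₀ → A u₀ ⊗ B u₀) U
    P-agrees : ∀ {u w} → u ∈ V₁ → w ∈ V₂ → eval P (u Vec.++ w) ≡ f (u Vec.++ w)
    P-agrees {u} {w} u∈V₁ w∈V₂ = begin
      eval P (u Vec.++ w)                                   ≡⟨ eval-concatMap _ U _ ⟩
      ∑ U (λ u₀ → eval (A u₀ ⊗ B u₀) (u Vec.++ w))           ≡⟨ ∑-cong U (λ {u₀} _ → eval-⊗ (A u₀) (B u₀) u w) ⟩
      ∑ U (λ u₀ → eval (A u₀) u * eval (B u₀) w)             ≡⟨ ∑-cong U (λ {u₀} _ → cong₂ _*_ (A-agrees u₀ u∈V₁) (B-agrees u₀ w∈V₂)) ⟩
      ∑ U (λ u₀ → δ u₀ u * f (u₀ Vec.++ w))                  ≡⟨ ∑-δ (deduplicate-! _≟ₚ_ V₁) (λ u₀ → f (u₀ Vec.++ w)) (∈-deduplicate⁺ _≟ₚ_ u∈V₁) ⟩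
      f (u Vec.++ w)                                         ∎

module ProductGröbner (F : FiniteField) {m₁ m₂ : ℕ}
  (V₁ : Poly.Subset F m₁) (V₂ : Poly.Subset F m₂) (G₁ : List (Poly.Pol F m₁)) (G₂ : List (Poly.Pol F m₂))
  (gb₁ : Poly.IsGröbnerGenSet F (Poly.𝕀 F V₁) G₁) (gb₂ : Poly.IsGröbnerGenSet F (Poly.𝕀 F V₂) G₂) where
  open FiniteField F
  open Poly F
  open FieldProperties F
  open PolynomialProperties F
  open Combinations F

  G : List (Pol (m₁ ℕ.+ m₂))
  G = map (embedˡ m₂) G₁ ++ map (embedʳ m₁) G₂

  generators-vanish : All (𝕀 (V₁ ×ˢ V₂)) G
  generators-vanish = All.++⁺
    (All.map⁺ (All.map (λ {g} g∈𝕀 → All-×ˢ⁺ V₁ V₂ λ u∈V₁ _ → trans (eval-embedˡ g _ _) (All.lookup g∈𝕀 u∈V₁)) (proj₁ gb₁)))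
    (All.map⁺ (All.map (λ {g} g∈𝕀 → All-×ˢ⁺ V₁ V₂ λ _ w∈V₂ → trans (eval-embedʳ g _ _) (All.lookup g∈𝕀 w∈V₂)) (proj₁ gb₂)))

  gröbner₁ : ∀ D {k} → 𝕀 V₁ D → DegLe D k → Combination G₁ k D
  gröbner₁ D D∈𝕀 D≤k = let (h , D≈ , bounded) = proj₂ gb₁ D D∈𝕀 _ D≤k in combination h D≈ bounded

  gröbner₂ : ∀ D {k} → 𝕀 V₂ D → DegLe D k → Combination G₂ k D
  gröbner₂ D D∈𝕀 D≤k = let (h , D≈ , bounded) = proj₂ gb₂ D D∈𝕀 _ D≤k in combination h D≈ bounded

  combinationˡ : ∀ c β {k D} → Combination G₁ k D → Combination G (k ℕ.+ totalDeg β) (liftˡ c β D)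
  combinationˡ c β = combination-++ˡ (map (embedʳ m₁) G₂)
    ∘ combination-map _ (embedˡ m₂) (liftˡ-cong c β) (liftˡ-*ₚ-embedˡ c β) (λ p → DegLe-liftˡ c β p)

  combinationʳ : ∀ γ {k D} → Combination G₂ k D → Combination G (totalDeg γ ℕ.+ k) (liftʳ γ D)
  combinationʳ γ = combination-++ʳ (map (embedˡ m₂) G₁)
    ∘ combination-map _ (embedʳ m₁) (liftʳ-cong γ) (liftʳ-*ₚ-embedʳ γ) (λ p → DegLe-liftʳ γ p)

  module Decomposition (P : Pol (m₁ ℕ.+ m₂)) (P∈𝕀 : 𝕀 (V₁ ×ˢ V₂) P) (d : ℕ) (P≤d : DegLe P d) where

    Term : Set
    Term = Carrier × Exp (m₁ ℕ.+ m₂)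

    T : Pol (m₁ ℕ.+ m₂)
    T = filter (λ t → totalDeg (proj₂ t) ℕ.≤? d) P

    coef : Term → Carrier
    coef = proj₁

    xexp : Term → Exp m₁
    xexp t = take m₁ (proj₂ t)

    yexp : Term → Exp m₂
    yexp t = drop m₁ (proj₂ t)

    exp-split : ∀ t → proj₂ t ≡ xexp t Vec.++ yexp t
    exp-split t = sym (Vec.take++drop≡id m₁ (proj₂ t))

    term-deg : ∀ {t} → t ∈ T → totalDeg (xexp t) ℕ.+ totalDeg (yexp t) ≤ d
    term-deg {t} t∈T = subst (_≤ d) (trans (cong totalDeg (exp-split t)) (Vec.sum-++ (xexp t)))
                             (proj₂ (∈-filter⁻ (λ t → totalDeg (proj₂ t) ℕ.≤? d) {xs = P} t∈T))

    open import Data.List.Membership.DecPropositional (_≟ₑ_ {m₁}) using (_∈?_)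
    open StandardMonomials F V₁ using (Reduction; reduction)
    open Reduction (reduction (map xexp T))

    r : Term → Pol m₁
    r t = reduce (xexp t)

    r-agrees : ∀ {t} → t ∈ T → ∀ {u} → u ∈ V₁ → eval (r t) u ≡ evalMono (xexp t) u
    r-agrees t∈T = reduce-agrees (∈-map⁺ xexp t∈T)

    r-deg : ∀ {t} → t ∈ T → DegLe (r t) (totalDeg (xexp t))
    r-deg t∈T = reduce-deg (∈-map⁺ xexp t∈T)

    D : Term → Pol m₁
    D t = (1# , xexp t) ∷ scale (- 1#) (r t)

    D∈𝕀 : ∀ {t} → t ∈ T → 𝕀 V₁ (D t)
    D∈𝕀 {t} t∈T = All.tabulate λ {u} u∈V₁ → begin
      1# * evalMono (xexp t) u + eval (scale (- 1#) (r t)) u  ≡⟨ cong₂ _+_ (*-idˡ _) (eval-scale (- 1#) (r t) u) ⟩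
      evalMono (xexp t) u + - 1# * eval (r t) u              ≡⟨ cong (λ x → evalMono (xexp t) u + - 1# * x) (r-agrees t∈T u∈V₁) ⟩
      evalMono (xexp t) u + - 1# * evalMono (xexp t) u       ≡⟨ cong (evalMono (xexp t) u +_) (-1*x≈-x _) ⟩
      evalMono (xexp t) u + - evalMono (xexp t) u            ≡⟨ -‿inverseʳ _ ⟩
      0#                                                     ∎
      where
      open ≡-Reasoning
      open import Algebra.Properties.Ring ring using (-1*x≈-x)

    D-deg : ∀ {t} → t ∈ T → DegLe (D t) (totalDeg (xexp t))
    D-deg {t} t∈T = DegLe-∷ 1# (xexp t) _ ℕ.≤-refl (DegLe-scale (- 1#) (r t) (r-deg t∈T))

    term-split : ∀ t → (t ∷ []) ≈ (liftˡ (coef t) (yexp t) (D t) +ₚ liftˡ (coef t) (yexp t) (r t))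
    term-split t e = begin
      coeff (t ∷ []) e
        ≡⟨ cong (λ x → coeff ((coef t , x) ∷ []) e) (exp-split t) ⟩
      coeff ((coef t , xexp t Vec.++ yexp t) ∷ []) e
        ≡⟨ cong (λ c → coeff ((c , xexp t Vec.++ yexp t) ∷ []) e) (*-identityʳ (coef t)) ⟨
      coeff (liftˡ (coef t) (yexp t) ((1# , xexp t) ∷ [])) e
        ≡⟨ liftˡ-cong (coef t) (yexp t) (D t +ₚ r t) ((1# , xexp t) ∷ []) D+r≈x^α e ⟨
      coeff (liftˡ (coef t) (yexp t) (D t +ₚ r t)) e
        ≡⟨ cong (λ p → coeff p e) (List.map-++ (λ (c , e) → (coef t * c , e Vec.++ yexp t)) (D t) (r t)) ⟩
      coeff (liftˡ (coef t) (yexp t) (D t) +ₚ liftˡ (coef t) (yexp t) (r t)) e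
        ∎
      where
      open ≡-Reasoning
      D+r≈x^α : (D t +ₚ r t) ≈ ((1# , xexp t) ∷ [])
      D+r≈x^α e = trans (coeff-+ₚ ((1# , xexp t) ∷ []) _ e)
        (trans (cong (coeff ((1# , xexp t) ∷ []) e +_) (scale-neg-cancel (r t) e)) (+-identityʳ _))

    -- the y-polynomial multiplying x^γ in Σ_t c_t y^{β_t} r(x^{α_t})
    q : Exp m₁ → Pol m₂
    q γ = concatMap (λ t → (coef t * coeff (r t) γ , yexp t) ∷ []) T

    -- only γ with |γ| ≤ d occur, so that d ∸ |γ| below is not a truncated subtraction
    Γ : List (Exp m₁)
    Γ = filter (λ γ → totalDeg γ ℕ.≤? d) (deduplicate _≟ₑ_ standard)

    Γ-unique : Unique Γ
    Γ-unique = Unique.filter⁺ (λ γ → totalDeg γ ℕ.≤? d) (deduplicate-! _≟ₑ_ standard)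

    Γ-deg : ∀ {γ} → γ ∈ Γ → totalDeg γ ≤ d
    Γ-deg γ∈Γ = proj₂ (∈-filter⁻ (λ γ → totalDeg γ ℕ.≤? d) {xs = deduplicate _≟ₑ_ standard} γ∈Γ)

    r-outside-Γ : ∀ {γ t} → γ ∉ Γ → t ∈ T → coeff (r t) γ ≡ 0#
    r-outside-Γ {γ} {t} γ∉Γ t∈T with γ ∈? standard
    ... | no γ∉S = coeff-unsupported (r t) (reduce-supported (xexp t)) γ∉S
    ... | yes γ∈S with totalDeg γ ℕ.≤? d
    ...   | yes γ≤d = contradiction (∈-filter⁺ (λ γ → totalDeg γ ℕ.≤? d) (∈-deduplicate⁺ _≟ₑ_ γ∈S) γ≤d) γ∉Γ
    ...   | no γ≰d  = r-deg t∈T γ (ℕ.≤-<-trans (ℕ.m+n≤o⇒m≤o _ (term-deg t∈T)) (ℕ.≰⇒> γ≰d))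

    QL : Pol (m₁ ℕ.+ m₂)
    QL = concatMap (λ t → liftˡ (coef t) (yexp t) (r t)) T

    QR : Pol (m₁ ℕ.+ m₂)
    QR = concatMap (λ γ → liftʳ γ (q γ)) Γ

    coeff-QL : ∀ x y → coeff QL (x Vec.++ y) ≡ coeff (q x) y
    coeff-QL x y = begin
      coeff QL (x Vec.++ y)                                              ≡⟨ coeff-concatMap _ T _ ⟩
      ∑ T (λ t → coeff (liftˡ (coef t) (yexp t) (r t)) (x Vec.++ y))      ≡⟨ ∑-cong T (λ {t} _ → coeff-liftˡ (coef t) (yexp t) (r t) x y) ⟩
      ∑ T (λ t → coeff ((coef t * coeff (r t) x , yexp t) ∷ []) y)       ≡⟨ coeff-concatMap _ T y ⟨
      coeff (q x) y                                                      ∎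
      where open ≡-Reasoning

    q-outside-Γ : ∀ {x} → x ∉ Γ → ∀ y → coeff (q x) y ≡ 0#
    q-outside-Γ x∉Γ y = trans (coeff-concatMap _ T y) (∑-zero T λ {t} t∈T →
      coeff-∷-vanishing (yexp t) [] y (λ _ → trans (cong (coef t *_) (r-outside-Γ x∉Γ t∈T)) (zeroʳ _)))

    -- Γ has no repetitions, so x^γ y^β only occurs in the summand liftʳ γ (q γ) of QR
    QL≈QR : QL ≈ QR
    QL≈QR e with splitAt m₁ e
    ... | x , y , refl with x ∈? Γ
    ...   | yes x∈Γ = begin
      coeff QL (x Vec.++ y)                            ≡⟨ coeff-QL x y ⟩
      coeff (q x) y                                    ≡⟨ coeff-liftʳ-≡ x (q x) y ⟨
      coeff (liftʳ x (q x)) (x Vec.++ y)               ≡⟨ ∑-unique Γ-unique x∈Γ (λ γ≢x → coeff-liftʳ-≢ (q _) y γ≢x) ⟨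
      ∑ Γ (λ γ → coeff (liftʳ γ (q γ)) (x Vec.++ y))   ≡⟨ coeff-concatMap _ Γ _ ⟨
      coeff QR (x Vec.++ y)                            ∎
      where open ≡-Reasoning
    ...   | no x∉Γ = begin
      coeff QL (x Vec.++ y)                            ≡⟨ coeff-QL x y ⟩
      coeff (q x) y                                    ≡⟨ q-outside-Γ x∉Γ y ⟩
      0#                                               ≡⟨ ∑-zero Γ (λ γ∈Γ → coeff-liftʳ-≢ (q _) y (λ { refl → x∉Γ γ∈Γ })) ⟨
      ∑ Γ (λ γ → coeff (liftʳ γ (q γ)) (x Vec.++ y))   ≡⟨ coeff-concatMap _ Γ _ ⟨
      coeff QR (x Vec.++ y)                            ∎
      where open ≡-Reasoning

    q-deg : ∀ γ → DegLe (q γ) (d ∸ totalDeg γ)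
    q-deg γ y d∸γ<y = trans (coeff-concatMap _ T y) (∑-zero T λ {t} t∈T →
      coeff-∷-vanishing (yexp t) [] y λ { refl →
        trans (cong (coef t *_) (r-deg t∈T γ (+≤∸<⇒< (term-deg t∈T) d∸γ<y))) (zeroʳ _) })

    -- T with y specialised to w, written in the standard monomials of V₁
    Q : Point m₂ → Pol m₁
    Q w = concatMap (λ t → scale (coef t * evalMono (yexp t) w) (r t)) T

    eval-q : ∀ γ w → eval (q γ) w ≡ coeff (Q w) γ
    eval-q γ w = begin
      eval (q γ) w                                                       ≡⟨ eval-concatMap _ T w ⟩
      ∑ T (λ t → (coef t * coeff (r t) γ) * evalMono (yexp t) w + 0#)    ≡⟨ ∑-cong T (λ {t} _ → term t) ⟩
      ∑ T (λ t → coeff (scale (coef t * evalMono (yexp t) w) (r t)) γ)   ≡⟨ coeff-concatMap _ T γ ⟨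
      coeff (Q w) γ                                                      ∎
      where
      open ≡-Reasoning
      open import Algebra.Properties.CommutativeSemigroup *-commutativeSemigroup using (xy∙z≈xz∙y)
      term : ∀ t → (coef t * coeff (r t) γ) * evalMono (yexp t) w + 0#
                   ≡ coeff (scale (coef t * evalMono (yexp t) w) (r t)) γ
      term t = trans (+-identityʳ _) (trans (xy∙z≈xz∙y _ _ _) (sym (coeff-scale _ (r t) γ)))

    eval-Q : ∀ {u} → u ∈ V₁ → ∀ w → eval (Q w) u ≡ eval P (u Vec.++ w)
    eval-Q {u} u∈V₁ w = begin
      eval (Q w) u                                                       ≡⟨ eval-concatMap _ T u ⟩
      ∑ T (λ t → eval (scale (coef t * evalMono (yexp t) w) (r t)) u)    ≡⟨ ∑-cong T term ⟩
      ∑ T (λ t → eval (t ∷ []) (u Vec.++ w))                             ≡⟨ eval-concatMap _ T _ ⟨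
      eval (concatMap (_∷ []) T) (u Vec.++ w)                            ≡⟨ cong (λ p → eval p (u Vec.++ w)) (List.concatMap-pure T) ⟩
      eval T (u Vec.++ w)                                                ≡⟨ eval-cong T P (DegLe⇒truncate≈ P P≤d) _ ⟩
      eval P (u Vec.++ w)                                                ∎
      where
      open ≡-Reasoning
      open import Algebra.Properties.CommutativeSemigroup *-commutativeSemigroup using (xy∙z≈x∙zy)
      term : ∀ {t} → t ∈ T → eval (scale (coef t * evalMono (yexp t) w) (r t)) u ≡ eval (t ∷ []) (u Vec.++ w)
      term {t} t∈T = begin
        eval (scale (coef t * evalMono (yexp t) w) (r t)) u      ≡⟨ eval-scale _ (r t) u ⟩
        (coef t * evalMono (yexp t) w) * eval (r t) u           ≡⟨ cong (_ *_) (r-agrees t∈T u∈V₁) ⟩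
        (coef t * evalMono (yexp t) w) * evalMono (xexp t) u    ≡⟨ xy∙z≈x∙zy _ _ _ ⟩
        coef t * (evalMono (xexp t) u * evalMono (yexp t) w)    ≡⟨ cong (coef t *_) (evalMono-++ (xexp t) (yexp t) u w) ⟨
        coef t * evalMono (xexp t Vec.++ yexp t) (u Vec.++ w)   ≡⟨ cong (λ e → coef t * evalMono e (u Vec.++ w)) (exp-split t) ⟨
        coef t * evalMono (proj₂ t) (u Vec.++ w)                ≡⟨ +-identityʳ _ ⟨
        eval (t ∷ []) (u Vec.++ w)                              ∎

    q∈𝕀 : ∀ γ → 𝕀 V₂ (q γ)
    q∈𝕀 γ = All.tabulate λ {w} w∈V₂ → trans (eval-q γ w) (independent (Q w) (Q-supported w) (Q∈𝕀 w∈V₂) γ)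
      where
      Q-supported : ∀ w → SupportedIn standard (Q w)
      Q-supported w = SupportedIn-concatMap _ T (λ {t} _ → SupportedIn-scale _ (reduce-supported (xexp t)))
      Q∈𝕀 : ∀ {w} → w ∈ V₂ → 𝕀 V₁ (Q w)
      Q∈𝕀 {w} w∈V₂ = All.tabulate λ u∈V₁ → trans (eval-Q u∈V₁ w) (All-×ˢ⁻ V₁ V₂ P∈𝕀 u∈V₁ w∈V₂)

    P≈ : P ≈ (concatMap (λ t → liftˡ (coef t) (yexp t) (D t)) T +ₚ QR)
    P≈ = begin
      P                                                                  ≈⟨ DegLe⇒truncate≈ P P≤d ⟨
      T                                                                  ≡⟨ List.concatMap-pure T ⟨
      concatMap (_∷ []) T                                                ≈⟨ concatMap-cong _ _ T (λ {t} _ → term-split t) ⟩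
      concatMap (λ t → liftˡ (coef t) (yexp t) (D t) +ₚ liftˡ (coef t) (yexp t) (r t)) T
                                                                         ≈⟨ concatMap-+ₚ _ _ T ⟩
      (concatMap (λ t → liftˡ (coef t) (yexp t) (D t)) T +ₚ QL)          ≈⟨ +ₚ-cong Dsum Dsum QL QR (λ _ → refl) QL≈QR ⟩
      (concatMap (λ t → liftˡ (coef t) (yexp t) (D t)) T +ₚ QR)          ∎
      where
      open import Relation.Binary.Reasoning.Setoid (≈-setoid {m₁ ℕ.+ m₂})
      Dsum = concatMap (λ t → liftˡ (coef t) (yexp t) (D t)) T

    decomposition : Combination G d P
    decomposition = combination-cong P≈ (combination-+ₚ
      (combination-concatMap _ T λ {t} t∈T → combination-mono (term-deg t∈T)
        (combinationˡ (coef t) (yexp t) (gröbner₁ (D t) (D∈𝕀 t∈T) (D-deg t∈T))))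
      (combination-concatMap _ Γ λ {γ} γ∈Γ → subst (λ k → Combination G k (liftʳ γ (q γ))) (ℕ.m+[n∸m]≡n (Γ-deg γ∈Γ))
        (combinationʳ γ (gröbner₂ (q γ) (q∈𝕀 γ) (q-deg γ)))))

  product-gröbner : IsGröbnerGenSet (𝕀 (V₁ ×ˢ V₂)) G
  product-gröbner = generators-vanish , λ P P∈𝕀 d P≤d →
    let combination h P≈ bounded = Decomposition.decomposition P P∈𝕀 d P≤d in h , P≈ , bounded

open import Data.Nat using (ℕ; _+_; _≤_)
open import Data.Product using (_×_)
open import Data.List using (List; map; _++_)

lemma4p5 : (F : FiniteField) → let open Poly F in
    ∀ (m₁ m₂ : ℕ) (V₁ : Subset m₁) (V₂ : Subset m₂) →
      Nonempty V₁ → Nonempty V₂ →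
      (∀ (G₁ : List (Pol m₁)) (G₂ : List (Pol m₂)) →
         IsGröbnerGenSet (𝕀 V₁) G₁ → IsGröbnerGenSet (𝕀 V₂) G₂ →
         IsGröbnerGenSet (𝕀 (V₁ ×ˢ V₂)) (map (embedˡ m₂) G₁ ++ map (embedʳ m₁) G₂))
      ×
      (∀ (d₁ d₂ : ℕ) → HasExtDeg V₁ d₁ → HasExtDeg V₂ d₂ →
         ExtendsWithDeg (V₁ ×ˢ V₂) (d₁ + d₂)
         × (∀ e → HasExtDeg (V₁ ×ˢ V₂) e → e ≤ d₁ + d₂))
lemma4p5 F m₁ m₂ V₁ V₂ _ _ =
  (λ G₁ G₂ gb₁ gb₂ → ProductGröbner.product-gröbner F V₁ V₂ G₁ G₂ gb₁ gb₂) ,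
  λ d₁ d₂ (E₁ , _) (E₂ , _) →
    let E = ProductExtension.product-extends F E₁ E₂ in E , λ _ (_ , minimal) → minimal (d₁ + d₂) E
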